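{- Fix $\epsilon<1/40$. Let $G$ be a graph, $P=K_3\times G$, $H$ be $\epsilon$-near $P$ via bijection $\psi$, $C$ the candidate edge graph and $\mathcal T(C)$ the triangle graph. Let $C_i$ be any connected component of $C$ and $Y_j$ any core component of $\mathcal T(C)$. Then either every core triangle whose vertices lie in $C_i$ belongs to $Y_j$, or no triangle of $Y_j$ contains a vertex of $C_i$.
   Context: Graphs are finite, undirected, simple, loopless. $\Gamma_X(v)$ is the neighbourhood of $v$ in $X$, $I_X(u,v)=\Gamma_X(u)\cap\Gamma_X(v)$. The tensor product $F\times G$ has vertex set $V(F)\times V(G)$, with $(f,g)$, $(f',g')$ adjacent iff $\{f,f'\}\in E(F)$ and $\{g,g'\}\in E(G)$. $K_3$ is the complete graph on $\{a,b,c\}$. $H$ is $\epsilon$-near $P=K_3\times G$ means: there is $E'\subseteq E(P)$ such that each vertex $w$ of $P$ has at most $\epsilon|\Gamma_P(w)|$ incident edges in $E'$, and a bijection $\psi:V(H)\to V(P)$, $\psi(v)=(\psi_{K_3}(v),\psi_G(v))$, which is a graph isomorphism from $H$ onto $(V(P),E(P)\setminus E')$. A core triangle is a set $\psi^{ -1}(\{a,b,c\}\times\{g\})$, $g\in V(G)$. The candidate edge graph $C$ has vertex set $V(H)$; distinct $u,v$ with $|\Gamma_H(u)|\ge|\Gamma_H(v)|$ are adjacent in $C$ iff (i) $|\Gamma_H(u)|-|\Gamma_H(v)|\le 2\epsilon|\Gamma_H(u)|$ and (ii) $(1-6\epsilon)\frac{|\Gamma_H(u)|}{2}\le|I_H(u,v)|\le\frac{1}{1-\epsilon}\cdot\frac{|\Gamma_H(u)|}{2}$.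 $\mathcal T(C)$ has as vertices the triangles of $C$ (3-sets pairwise adjacent in $C$); $T_1,T_2$ are adjacent (compatible) iff disjoint and there are indexings $T_1=\{u_1,u_2,u_3\}$, $T_2=\{v_1,v_2,v_3\}$ with $\{u_i,v_j\}\in E(H)$ iff $i\ne j$. Vertices $g,g'$ of $G$ are $\epsilon$-confusable if $|I_G(g,g')|>(1-9\epsilon)\max\{|\Gamma_G(g)|,|\Gamma_G(g')|\}$. A 3-set of vertices of $H$ is quasi-core if its color classes $\psi_{K_3}$ are pairwise distinct and its $G$-classes $\psi_G$ are pairwise $\epsilon$-confusable. A core component of $\mathcal T(C)$ is a connected component all of whose triangles are quasi-core. -}

module Defs where

open import Data.Nat as ℕ using (ℕ; zero; suc)
open import Data.Integer using (+_)
open import Data.Bool using (Bool; true; false; if_then_else_; _∧_; not)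
open import Data.Fin as Fin using (Fin)
open import Data.Product using (Σ; ∃; _×_; _,_; proj₁; proj₂)
open import Data.Sum using (_⊎_)
open import Data.Rational as ℚ using (ℚ; 1ℚ; ½; _/_)
open import Function.Definitions using (Bijective)
open import Relation.Binary.PropositionalEquality using (_≡_; _≢_)
open import Relation.Nullary using (¬_)
open import Relation.Nullary.Decidable using (⌊_⌋)
open import Function.Bundles using (_⇔_)

record Graph (n : ℕ) : Set where
  field
    adj    : Fin n → Fin n → Bool
    sym    : ∀ u v → adj u v ≡ adj v u
    irrefl : ∀ v → adj v v ≡ false
open Graph public

sumFin : ∀ {n} → (Fin n → ℕ) → ℕ
sumFin {zero}  f = 0
sumFin {suc n} f = f Fin.zero ℕ.+ sumFin (λ i → f (Fin.suc i))

count : ∀ {n} → (Fin n → Bool) → ℕ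
count f = sumFin (λ i → if f i then 1 else 0)

deg : ∀ {n} → Graph n → Fin n → ℕ
deg X v = count (adj X v)

common : ∀ {n} → Graph n → Fin n → Fin n → ℕ
common X u v = count (λ w → adj X u w ∧ adj X v w)

⟦_⟧ : ℕ → ℚ
⟦ k ⟧ = + k / 1

-- The tensor product P = K₃ × G, vertex set Fin 3 × Fin m
-- (Fin 3 = {a,b,c}, the vertices of K₃)

PV : ℕ → Set
PV m = Fin 3 × Fin m

Padj : ∀ {m} → Graph m → PV m → PV m → Bool
Padj G (f , g) (f' , g') = not ⌊ f Fin.≟ f' ⌋ ∧ adj G g g'

countP : ∀ {m} → (PV m → Bool) → ℕ
countP f = sumFin (λ i → count (λ j → f (i , j)))

degP : ∀ {m} → Graph m → PV m → ℕ
degP G w = countP (Padj G w)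

record Near (ε : ℚ) {m n : ℕ} (G : Graph m) (H : Graph n) : Set where
  field
    ψ        : Fin n → PV m
    ψ-bij    : Bijective _≡_ _≡_ ψ
    E'       : PV m → PV m → Bool
    E'-sym   : ∀ x y → E' x y ≡ E' y x
    E'⊆EP    : ∀ x y → E' x y ≡ true → Padj G x y ≡ true
    E'-small : ∀ w → ⟦ countP (E' w) ⟧ ℚ.≤ ε ℚ.* ⟦ degP G w ⟧
    iso      : ∀ u v → adj H u v ≡ (Padj G (ψ u) (ψ v) ∧ not (E' (ψ u) (ψ v)))

  ψK : Fin n → Fin 3
  ψK v = proj₁ (ψ v)

  ψG : Fin n → Fin m
  ψG v = proj₂ (ψ v)
open Near public

-- conditions (i),(ii) for the ordered pair (u,v) with |Γ_H(u)| ≥ |Γ_H(v)|;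
-- the upper bound |I| ≤ (1/(1-ε))·|Γ(u)|/2 is written multiplied out as
-- (1-ε)·|I| ≤ |Γ(u)|/2 (equivalent since 1-ε > 0).
CandCond : ∀ {n} → ℚ → Graph n → Fin n → Fin n → Set
CandCond ε H u v =
  (⟦ deg H u ⟧ ℚ.- ⟦ deg H v ⟧ ℚ.≤ (⟦ 2 ⟧ ℚ.* ε) ℚ.* ⟦ deg H u ⟧)
  × ((1ℚ ℚ.- ⟦ 6 ⟧ ℚ.* ε) ℚ.* (⟦ deg H u ⟧ ℚ.* ½) ℚ.≤ ⟦ common H u v ⟧)
  × ((1ℚ ℚ.- ε) ℚ.* ⟦ common H u v ⟧ ℚ.≤ ⟦ deg H u ⟧ ℚ.* ½)

-- u,v adjacent in C: distinct, and the conditions hold for the pair ordered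
-- so that the first has the larger degree (for equal degrees both orders
-- give the same conditions).
CAdj : ∀ {n} → ℚ → Graph n → Fin n → Fin n → Set
CAdj ε H u v =
  u ≢ v
  × (deg H v ℕ.≤ deg H u → CandCond ε H u v)
  × (deg H u ℕ.≤ deg H v → CandCond ε H v u)

data CReach {n : ℕ} (ε : ℚ) (H : Graph n) (c : Fin n) : Fin n → Set where
  here : CReach ε H c c
  step : ∀ {v w} → CReach ε H c v → CAdj ε H v w → CReach ε H c w

-- Triangles of C, represented as sorted triples (x < y < z), so that a
-- 3-set corresponds to exactly one triple.

Triple : ℕ → Set
Triple n = Fin n × Fin n × Fin n

_∈T_ : ∀ {n} → Fin n → Triple n → Set
v ∈T (x , y , z) = v ≡ x ⊎ v ≡ y ⊎ v ≡ z

Sorted : ∀ {n} → Triple n → Set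
Sorted (x , y , z) = x Fin.< y × y Fin.< z

IsTri : ∀ {n} → ℚ → Graph n → Triple n → Set
IsTri ε H t@(x , y , z) =
  Sorted t × CAdj ε H x y × CAdj ε H x z × CAdj ε H y z

Indexing : ∀ {n} → Triple n → (Fin 3 → Fin n) → Set
Indexing t α = (∀ i → α i ∈T t) × (∀ v → v ∈T t → ∃ λ i → α i ≡ v)

Compatible : ∀ {n} → Graph n → Triple n → Triple n → Set
Compatible {n} H t s =
  (∀ v → v ∈T t → ¬ (v ∈T s))
  × Σ (Fin 3 → Fin n) λ α → Σ (Fin 3 → Fin n) λ β →
      Indexing t α × Indexing s β
      × (∀ i j → (adj H (α i) (β j) ≡ true) ⇔ (i ≢ j))

TAdj : ∀ {n} → ℚ → Graph n → Triple n → Triple n → Set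
TAdj ε H t s = IsTri ε H t × IsTri ε H s × Compatible H t s

data TReach {n : ℕ} (ε : ℚ) (H : Graph n) (t : Triple n) : Triple n → Set where
  here : TReach ε H t t
  step : ∀ {s r} → TReach ε H t s → TAdj ε H s r → TReach ε H t r

Confusable : ∀ {m} → ℚ → Graph m → Fin m → Fin m → Set
Confusable ε G g g' =
  (1ℚ ℚ.- ⟦ 9 ⟧ ℚ.* ε) ℚ.* ⟦ deg G g ℕ.⊔ deg G g' ⟧ ℚ.< ⟦ common G g g' ⟧

module _ {ε : ℚ} {m n : ℕ} {G : Graph m} {H : Graph n} (N : Near ε G H) where

  QuasiCore : Triple n → Set
  QuasiCore (x , y , z) =
    ψK N x ≢ ψK N y × ψK N x ≢ ψK N z × ψK N y ≢ ψK N z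
    × Confusable ε G (ψG N x) (ψG N y)
    × Confusable ε G (ψG N x) (ψG N z)
    × Confusable ε G (ψG N y) (ψG N z)

  -- the component of 𝒯(C) containing the triangle t₀ is a core component
  CoreComponent : Triple n → Set
  CoreComponent t₀ = IsTri ε H t₀ × (∀ s → TReach ε H t₀ s → QuasiCore s)

  -- t is (the sorted triple of) the core triangle ψ⁻¹({a,b,c} × {g})
  IsCoreTriangle : Fin m → Triple n → Set
  IsCoreTriangle g t = Sorted t × (∀ v → (v ∈T t) ⇔ (ψG N v ≡ g))

{-# OPTIONS --safe #-}
-- Call a vertex g of G reached if every core triangle over g lies in the component of 𝒯(C)
-- containing t₀. Core triangles are triangles of C, and the core triangles over adjacent
-- vertices g, h of G are compatible as soon as no edge between the fibres over g and h was
-- removed. Counting removed edges shows that such a clean common neighbour h exists for the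
-- two endpoints of a candidate edge, whose neighbourhoods in G overlap substantially, and for
-- the three vertices of a quasi-core triangle, which are pairwise confusable. Hence being
-- reached spreads along the edges of C, and the vertices of every triangle of the core
-- component are reached. Reachability in 𝒯(C) is decidable: if the core triangle over c₀ is
-- reached then so is every vertex of the component of c₀, and otherwise no triangle of the
-- core component meets that component.
module Submission where

open import Defs hiding (sym)
open import Data.Nat as ℕ using (ℕ; zero; suc; z≤n; s≤s)
import Data.Nat.Properties as ℕₚ
open import Data.Integer using (+_)
open import Data.Rational as ℚ using (ℚ; _<_; _/_)
import Data.Rational.Properties as ℚₚ
open import Data.Bool using (Bool; true; false; if_then_else_; _∧_; _∨_; not)
import Data.Bool.Properties as Boolₚ
open import Data.Fin as Fin using (Fin; remQuot; combine; _↑ˡ_; _↑ʳ_)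
import Data.Fin.Properties as Finₚ
open import Data.Fin.Patterns using (0F; 1F; 2F)
open import Data.Fin.Permutation using (Permutation; _⟨$⟩ʳ_)
open import Data.Empty using (⊥-elim)
open import Data.List using (List; []; _∷_; map; cartesianProduct; allFin)
open import Data.Nat.ListAction using (sum)
open import Data.List.Membership.Propositional using (_∈_; _∉_; find; lose)
open import Data.List.Membership.Propositional.Properties using (∈-cartesianProduct⁺; ∈-allFin)
open import Data.List.Relation.Unary.Any as Any using (Any; here; there)
open import Data.Product using (Σ; ∃; _×_; _,_; proj₁; proj₂)
open import Data.Product.Properties using (≡-dec)
open import Data.Sum using (_⊎_; inj₁; inj₂; [_,_]′)
open import Function using (_∘_; id; Inverse)
open import Function.Bundles using (mk⤖; _⇔_; _↔_; mk⇔; Equivalence)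
open import Function.Definitions using (Bijective)
open import Function.Properties.Bijection using (⤖⇒↔)
open import Function.Properties.Inverse using (↔-sym; ↔-trans)
open import Relation.Binary.Definitions using (DecidableEquality; tri<; tri≈; tri>)
open import Relation.Binary.PropositionalEquality
open import Relation.Nullary using (¬_; Dec; does; yes; no; ¬?; contradiction)
open import Relation.Nullary.Decidable using (⌊_⌋; _×-dec_; _⊎-dec_; _→-dec_; map′)

module Arithmetic where

  import Data.Integer as ℤ
  import Data.Integer.Properties as ℤₚ
  open import Data.Rational
    using (mkℚ; nonNegative; positive; 0ℚ; 1ℚ; ½; _≤_; _+_; _*_; _-_; -_; *≤*; *<*)
  open import Data.Nat.Coprimality using (1-coprimeTo) renaming (sym to coprime-sym)
  open import Data.Empty using (⊥)
  open import Relation.Nullary.Decidable using (True; toWitness; dec⇒maybe)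
  open import Tactic.RingSolver using (solve-∀)
  open import Tactic.RingSolver.Core.AlmostCommutativeRing using (AlmostCommutativeRing; fromCommutativeRing)

  ℚ-ring : AlmostCommutativeRing _ _
  ℚ-ring = fromCommutativeRing ℚₚ.+-*-commutativeRing (λ x → dec⇒maybe (0ℚ ℚₚ.≟ x))

  ⟦⟧-mkℚ : ∀ k → ⟦ k ⟧ ≡ mkℚ (+ k) 0 (coprime-sym (1-coprimeTo k))
  ⟦⟧-mkℚ k = ℚₚ.normalize-coprime (coprime-sym (1-coprimeTo k))

  ⟦⟧-+ : ∀ a b → ⟦ a ℕ.+ b ⟧ ≡ ⟦ a ⟧ + ⟦ b ⟧
  ⟦⟧-+ a b = trans (ℚₚ./-cong {p₁ = + (a ℕ.+ b)} {q₁ = 1}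
                      (cong₂ ℤ._+_ (sym (ℤₚ.*-identityʳ (+ a))) (sym (ℤₚ.*-identityʳ (+ b)))) refl)
                   (sym (cong₂ _+_ (⟦⟧-mkℚ a) (⟦⟧-mkℚ b)))

  ⟦⟧-* : ∀ a b → ⟦ a ℕ.* b ⟧ ≡ ⟦ a ⟧ * ⟦ b ⟧
  ⟦⟧-* a b = trans (ℚₚ./-cong {p₁ = + (a ℕ.* b)} {q₁ = 1} (ℤₚ.pos-* a b) refl)
                   (sym (cong₂ _*_ (⟦⟧-mkℚ a) (⟦⟧-mkℚ b)))

  ⟦⟧-mono-≤ : ∀ {a b} → a ℕ.≤ b → ⟦ a ⟧ ≤ ⟦ b ⟧
  ⟦⟧-mono-≤ {a} {b} a≤b = subst₂ _≤_ (sym (⟦⟧-mkℚ a)) (sym (⟦⟧-mkℚ b))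
    (*≤* (subst₂ ℤ._≤_ (sym (ℤₚ.*-identityʳ (+ a))) (sym (ℤₚ.*-identityʳ (+ b))) (ℤ.+≤+ a≤b)))

  ⟦⟧-mono-< : ∀ {a b} → a ℕ.< b → ⟦ a ⟧ < ⟦ b ⟧
  ⟦⟧-mono-< {a} {b} a<b = subst₂ _<_ (sym (⟦⟧-mkℚ a)) (sym (⟦⟧-mkℚ b))
    (*<* (subst₂ ℤ._<_ (sym (ℤₚ.*-identityʳ (+ a))) (sym (ℤₚ.*-identityʳ (+ b))) (ℤ.+<+ a<b)))

  ⟦⟧-cancel-< : ∀ {a b} → ⟦ a ⟧ < ⟦ b ⟧ → a ℕ.< b
  ⟦⟧-cancel-< {a} {b} a<b with subst₂ _<_ (⟦⟧-mkℚ a) (⟦⟧-mkℚ b) a<b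
  ... | *<* p with subst₂ ℤ._<_ (ℤₚ.*-identityʳ (+ a)) (ℤₚ.*-identityʳ (+ b)) p
  ...   | ℤ.+<+ a<b′ = a<b′

  0≤⟦⟧ : ∀ k → 0ℚ ≤ ⟦ k ⟧
  0≤⟦⟧ k = ⟦⟧-mono-≤ {0} {k} ℕ.z≤n

  0≤! : ∀ c {_ : True (0ℚ ℚₚ.≤? c)} → 0ℚ ≤ c
  0≤! c {0≤c} = toWitness 0≤c

  0<! : ∀ c {_ : True (0ℚ ℚₚ.<? c)} → 0ℚ < c
  0<! c {0<c} = toWitness 0<c

  q-p+p≡q : ∀ q p → (q - p) + p ≡ q
  q-p+p≡q = solve-∀ ℚ-ring

  module _ {p q : ℚ} where

    p≤q⇒0≤q-p : p ≤ q → 0ℚ ≤ q - p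
    p≤q⇒0≤q-p p≤q = ℚₚ.≤-trans (ℚₚ.≤-reflexive (sym (ℚₚ.+-inverseʳ p))) (ℚₚ.+-monoˡ-≤ (- p) p≤q)

    p<q⇒0<q-p : p < q → 0ℚ < q - p
    p<q⇒0<q-p p<q = ℚₚ.≤-<-trans (ℚₚ.≤-reflexive (sym (ℚₚ.+-inverseʳ p))) (ℚₚ.+-monoˡ-< (- p) p<q)

    0≤q-p⇒p≤q : 0ℚ ≤ q - p → p ≤ q
    0≤q-p⇒p≤q 0≤q-p = subst₂ _≤_ (ℚₚ.+-identityˡ p) (q-p+p≡q q p) (ℚₚ.+-monoˡ-≤ p 0≤q-p)

    0<q-p⇒p<q : 0ℚ < q - p → p < q
    0<q-p⇒p<q 0<q-p = subst₂ _<_ (ℚₚ.+-identityˡ p) (q-p+p≡q q p) (ℚₚ.+-monoˡ-< p 0<q-p)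

  0≤+ : ∀ {a b} → 0ℚ ≤ a → 0ℚ ≤ b → 0ℚ ≤ a + b
  0≤+ = ℚₚ.+-mono-≤

  0<+ : ∀ {a b} → 0ℚ < a → 0ℚ ≤ b → 0ℚ < a + b
  0<+ = ℚₚ.+-mono-<-≤

  0≤* : ∀ {a b} → 0ℚ ≤ a → 0ℚ ≤ b → 0ℚ ≤ a * b
  0≤* {a} {b} 0≤a 0≤b = ℚₚ.nonNegative⁻¹ _
    {{ℚₚ.nonNeg*nonNeg⇒nonNeg a {{nonNegative 0≤a}} b {{nonNegative 0≤b}}}}

  0<* : ∀ {a b} → 0ℚ < a → 0ℚ < b → 0ℚ < a * b
  0<* {a} {b} 0<a 0<b = ℚₚ.positive⁻¹ _
    {{ℚₚ.pos*pos⇒pos a {{positive 0<a}} b {{positive 0<b}}}}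

  -- Each estimate below is proved by exhibiting the difference of its two sides, via the
  -- ring solver, as a sum of products of quantities known to be nonnegative.
  ≤-by : ∀ {p q r} → 0ℚ ≤ r → r ≡ q - p → p ≤ q
  ≤-by 0≤r r≡q-p = 0≤q-p⇒p≤q (subst (0ℚ ≤_) r≡q-p 0≤r)

  <-by : ∀ {p q r} → 0ℚ < r → r ≡ q - p → p < q
  <-by 0<r r≡q-p = 0<q-p⇒p<q (subst (0ℚ <_) r≡q-p 0<r)

  ⊥-by : ∀ {p r} → 0ℚ < p → 0ℚ ≤ r → r ≡ - p → ⊥
  ⊥-by {p} 0<p 0≤r r≡-p = ℚₚ.<-irrefl refl
    (ℚₚ.<-≤-trans (0<+ 0<p (subst (0ℚ ≤_) r≡-p 0≤r)) (ℚₚ.≤-reflexive (ℚₚ.+-inverseʳ p)))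

  1/40 : ℚ
  1/40 = + 1 / 40

  module Estimates {ε : ℚ} (0≤ε : 0ℚ ≤ ε) (ε≤1/40 : ε ≤ 1/40) where

    private
      0≤1/40-ε : 0ℚ ≤ 1/40 - ε
      0≤1/40-ε = p≤q⇒0≤q-p ε≤1/40

      0≤2 : 0ℚ ≤ ⟦ 2 ⟧
      0≤2 = 0≤⟦⟧ 2

    fibre-pair-candidate : ∀ d du dv eu ev c → 0ℚ ≤ d →
      du ≤ ⟦ 2 ⟧ * d → ⟦ 2 ⟧ * d ≤ du + eu → ⟦ 2 ⟧ * d ≤ dv + ev →
      eu ≤ ε * (⟦ 2 ⟧ * d) → ev ≤ ε * (⟦ 2 ⟧ * d) → d ≤ c + eu + ev → c ≤ d →
      (du - dv ≤ (⟦ 2 ⟧ * ε) * du) × ((1ℚ - ⟦ 6 ⟧ * ε) * (du * ½) ≤ c) × ((1ℚ - ε) * c ≤ du * ½)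
    fibre-pair-candidate d du dv eu ev c 0≤d du≤ ≤du ≤dv eu≤ ev≤ d≤ c≤d =
      ≤-by (0≤+ (0≤+ (0≤+ (0≤+ (0≤+ (p≤q⇒0≤q-p ≤dv) (p≤q⇒0≤q-p du≤)) (p≤q⇒0≤q-p ev≤))
                               (0≤* (0≤* 0≤2 0≤ε) (p≤q⇒0≤q-p ≤du)))
                          (0≤* (0≤* 0≤2 0≤ε) (p≤q⇒0≤q-p eu≤)))
                     (0≤* (0≤* (0≤* 0≤2 0≤ε) 0≤d) (0≤+ (0≤* 0≤2 0≤1/40-ε) (0≤! (+ 19 / 20)))))
           (degree-gap ε d du dv eu ev) ,
      ≤-by (0≤+ (0≤+ (0≤+ (0≤+ (p≤q⇒0≤q-p d≤) (p≤q⇒0≤q-p eu≤)) (p≤q⇒0≤q-p ev≤))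
                          (0≤* (0≤* (0≤+ (0≤* (0≤⟦⟧ 6) 0≤1/40-ε) (0≤! (+ 17 / 20))) (0≤! ½)) (p≤q⇒0≤q-p du≤)))
                     (0≤* (0≤* 0≤2 0≤ε) 0≤d))
           (common-lower ε d du eu ev c) ,
      ≤-by (0≤+ (0≤+ (0≤* (0≤! ½) (p≤q⇒0≤q-p ≤du)) (0≤* (0≤! ½) (p≤q⇒0≤q-p eu≤)))
                (0≤* (0≤+ 0≤1/40-ε (0≤! (+ 39 / 40))) (p≤q⇒0≤q-p c≤d)))
           (common-upper ε d du eu c)
      where
      degree-gap : ∀ ε d du dv eu ev →
        (((((dv + ev - ⟦ 2 ⟧ * d) + (⟦ 2 ⟧ * d - du)) + (ε * (⟦ 2 ⟧ * d) - ev))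
          + (⟦ 2 ⟧ * ε) * (du + eu - ⟦ 2 ⟧ * d)) + (⟦ 2 ⟧ * ε) * (ε * (⟦ 2 ⟧ * d) - eu))
          + ((⟦ 2 ⟧ * ε) * d) * (⟦ 2 ⟧ * (1/40 - ε) + + 19 / 20)
        ≡ (⟦ 2 ⟧ * ε) * du - (du - dv)
      degree-gap = solve-∀ ℚ-ring
      common-lower : ∀ ε d du eu ev c →
        ((((c + eu + ev - d) + (ε * (⟦ 2 ⟧ * d) - eu)) + (ε * (⟦ 2 ⟧ * d) - ev))
          + ((⟦ 6 ⟧ * (1/40 - ε) + + 17 / 20) * ½) * (⟦ 2 ⟧ * d - du)) + (⟦ 2 ⟧ * ε) * d
        ≡ c - (1ℚ - ⟦ 6 ⟧ * ε) * (du * ½)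
      common-lower = solve-∀ ℚ-ring
      common-upper : ∀ ε d du eu c →
        (½ * (du + eu - ⟦ 2 ⟧ * d) + ½ * (ε * (⟦ 2 ⟧ * d) - eu)) + ((1/40 - ε) + + 39 / 40) * (d - c)
        ≡ du * ½ - (1ℚ - ε) * c
      common-upper = solve-∀ ℚ-ring

    candidate-few-dirty : ∀ D Dv c I dg dg′ eu ev bad E E′ → 0ℚ < D → 0ℚ ≤ dg → 0ℚ ≤ dg′ →
      (1ℚ - ⟦ 6 ⟧ * ε) * (D * ½) ≤ c → c ≤ ⟦ 2 ⟧ * I →
      ⟦ 2 ⟧ * dg ≤ D + eu → eu ≤ ε * (⟦ 2 ⟧ * dg) →
      ⟦ 2 ⟧ * dg′ ≤ Dv + ev → ev ≤ ε * (⟦ 2 ⟧ * dg′) → Dv ≤ D →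
      bad ≤ E + E′ → E ≤ ⟦ 6 ⟧ * (ε * dg) → E′ ≤ ⟦ 6 ⟧ * (ε * dg′) →
      bad < I
    candidate-few-dirty D Dv c I dg dg′ eu ev bad E E′
      0<D 0≤dg 0≤dg′ c≥ c≤ ≤D eu≤ ≤Dv ev≤ Dv≤D bad≤ E≤ E′≤ =
      <-by (0<+ (0<* 0<D (0<+ (0<! (+ 183 / 3120)) (0≤* (0≤! (+ 597 / 78)) 0≤1/40-ε)))
        (0≤+ (0≤+ (0≤+ (0≤+ (0≤+ (0≤+ (0≤* (0≤! ½) (p≤q⇒0≤q-p c≤)) (0≤* (0≤! ½) (p≤q⇒0≤q-p c≥)))
                                      (p≤q⇒0≤q-p bad≤)) (p≤q⇒0≤q-p E≤)) (p≤q⇒0≤q-p E′≤))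
          (0≤* (0≤* (0≤! (+ 120 / 39)) 0≤ε)
            (0≤+ (0≤+ (p≤q⇒0≤q-p ≤D) (p≤q⇒0≤q-p eu≤)) (0≤* (0≤* 0≤2 0≤dg) 0≤1/40-ε))))
          (0≤* (0≤* (0≤! (+ 120 / 39)) 0≤ε)
            (0≤+ (0≤+ (0≤+ (p≤q⇒0≤q-p Dv≤D) (p≤q⇒0≤q-p ≤Dv)) (p≤q⇒0≤q-p ev≤)) (0≤* (0≤* 0≤2 0≤dg′) 0≤1/40-ε)))))
        (identity ε D Dv c I dg dg′ eu ev bad E E′)
      where
      identity : ∀ ε D Dv c I dg dg′ eu ev bad E E′ →
        D * (+ 183 / 3120 + + 597 / 78 * (1/40 - ε)) +
        ((((((½ * (⟦ 2 ⟧ * I - c) + ½ * (c - (1ℚ - ⟦ 6 ⟧ * ε) * (D * ½))) + (E + E′ - bad))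
             + (⟦ 6 ⟧ * (ε * dg) - E)) + (⟦ 6 ⟧ * (ε * dg′) - E′))
          + (+ 120 / 39 * ε) * (((D + eu - ⟦ 2 ⟧ * dg) + (ε * (⟦ 2 ⟧ * dg) - eu)) + (⟦ 2 ⟧ * dg) * (1/40 - ε)))
          + (+ 120 / 39 * ε) * ((((D - Dv) + (Dv + ev - ⟦ 2 ⟧ * dg′)) + (ε * (⟦ 2 ⟧ * dg′) - ev))
                                + (⟦ 2 ⟧ * dg′) * (1/40 - ε)))
        ≡ I - bad
      identity = solve-∀ ℚ-ring

    quasi-core-few-dirty : ∀ T d₁ d₂ d₃ M₂ M₃ I₂ I₃ e₁ e₂ e₃ E bad → 0ℚ ≤ M₂ → 0ℚ ≤ M₃ →
      I₂ + I₃ ≤ T + d₁ → (1ℚ - ⟦ 9 ⟧ * ε) * M₂ < I₂ → (1ℚ - ⟦ 9 ⟧ * ε) * M₃ < I₃ →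
      d₁ ≤ M₂ → d₂ ≤ M₂ → d₁ ≤ M₃ → d₃ ≤ M₃ →
      bad ≤ e₁ + e₂ + e₃ + E →
      e₁ ≤ ε * (⟦ 2 ⟧ * d₁) → e₂ ≤ ε * (⟦ 2 ⟧ * d₂) → e₃ ≤ ε * (⟦ 2 ⟧ * d₃) → E ≤ ⟦ 6 ⟧ * (ε * d₁) →
      bad < T
    quasi-core-few-dirty T d₁ d₂ d₃ M₂ M₃ I₂ I₃ e₁ e₂ e₃ E bad
      0≤M₂ 0≤M₃ T≥ I₂> I₃> d₁≤M₂ d₂≤M₂ d₁≤M₃ d₃≤M₃ bad≤ e₁≤ e₂≤ e₃≤ E≤ =
      <-by (0<+ (p<q⇒0<q-p I₂>)
        (0≤+ (0≤+ (0≤+ (0≤+ (0≤+ (0≤+ (0≤+ (0≤+ (0≤+ (0≤+ (0≤+ (0≤+ (p≤q⇒0≤q-p T≥) (ℚₚ.<⇒≤ (p<q⇒0<q-p I₃>)))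
          (p≤q⇒0≤q-p bad≤)) (p≤q⇒0≤q-p e₁≤)) (p≤q⇒0≤q-p e₂≤)) (p≤q⇒0≤q-p e₃≤)) (p≤q⇒0≤q-p E≤))
          (0≤* (0≤+ (0≤! ½) (0≤* (0≤⟦⟧ 4) 0≤ε)) (p≤q⇒0≤q-p d₁≤M₂))) (0≤* (0≤* 0≤2 0≤ε) (p≤q⇒0≤q-p d₂≤M₂)))
          (0≤* (0≤+ (0≤* (0≤⟦⟧ 15) 0≤1/40-ε) (0≤! (+ 1 / 8))) 0≤M₂))
          (0≤* (0≤+ (0≤! ½) (0≤* (0≤⟦⟧ 4) 0≤ε)) (p≤q⇒0≤q-p d₁≤M₃))) (0≤* (0≤* 0≤2 0≤ε) (p≤q⇒0≤q-p d₃≤M₃)))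
          (0≤* (0≤+ (0≤* (0≤⟦⟧ 15) 0≤1/40-ε) (0≤! (+ 1 / 8))) 0≤M₃)))
        (identity ε T d₁ d₂ d₃ M₂ M₃ I₂ I₃ e₁ e₂ e₃ E bad)
      where
      identity : ∀ ε T d₁ d₂ d₃ M₂ M₃ I₂ I₃ e₁ e₂ e₃ E bad →
        (I₂ - (1ℚ - ⟦ 9 ⟧ * ε) * M₂) +
        ((((((((((((((T + d₁) - (I₂ + I₃)) + (I₃ - (1ℚ - ⟦ 9 ⟧ * ε) * M₃)) + ((e₁ + e₂ + e₃ + E) - bad))
          + (ε * (⟦ 2 ⟧ * d₁) - e₁)) + (ε * (⟦ 2 ⟧ * d₂) - e₂)) + (ε * (⟦ 2 ⟧ * d₃) - e₃)) + (⟦ 6 ⟧ * (ε * d₁) - E))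
          + (½ + ⟦ 4 ⟧ * ε) * (M₂ - d₁)) + (⟦ 2 ⟧ * ε) * (M₂ - d₂)) + (⟦ 15 ⟧ * (1/40 - ε) + + 1 / 8) * M₂)
          + (½ + ⟦ 4 ⟧ * ε) * (M₃ - d₁)) + (⟦ 2 ⟧ * ε) * (M₃ - d₃)) + (⟦ 15 ⟧ * (1/40 - ε) + + 1 / 8) * M₃)
        ≡ T - bad
      identity = solve-∀ ℚ-ring

    candidate-degree-gap : ∀ du → 0ℚ < du → ¬ (du - ⟦ 0 ⟧ ≤ (⟦ 2 ⟧ * ε) * du)
    candidate-degree-gap du 0<du gap =
      ⊥-by (0<* 0<du (0<+ (0<! (+ 19 / 20)) (0≤* 0≤2 0≤1/40-ε))) (p≤q⇒0≤q-p gap) (identity ε du)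
      where
      identity : ∀ ε du → (⟦ 2 ⟧ * ε) * du - (du - ⟦ 0 ⟧) ≡ - (du * (+ 19 / 20 + ⟦ 2 ⟧ * (1/40 - ε)))
      identity = solve-∀ ℚ-ring

    fibre-degree-gap : ∀ d e → 0ℚ < d → ⟦ 2 ⟧ * d ≤ ⟦ 0 ⟧ + e → ¬ (e ≤ ε * (⟦ 2 ⟧ * d))
    fibre-degree-gap d e 0<d 2d≤e e≤ =
      ⊥-by (0<* 0<d (0<+ (0<! (+ 39 / 20)) (0≤* 0≤2 0≤1/40-ε)))
           (0≤+ (p≤q⇒0≤q-p 2d≤e) (p≤q⇒0≤q-p e≤)) (identity ε d e)
      where
      identity : ∀ ε d e → (⟦ 0 ⟧ + e - ⟦ 2 ⟧ * d) + (ε * (⟦ 2 ⟧ * d) - e)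
                           ≡ - (d * (+ 39 / 20 + ⟦ 2 ⟧ * (1/40 - ε)))
      identity = solve-∀ ℚ-ring

    confusable-gap : ∀ M → 0ℚ ≤ M → ¬ ((1ℚ - ⟦ 9 ⟧ * ε) * M < ⟦ 0 ⟧)
    confusable-gap M 0≤M M< =
      ⊥-by (p<q⇒0<q-p M<) (0≤* (0≤+ (0≤* (0≤⟦⟧ 9) 0≤1/40-ε) (0≤! (+ 31 / 40))) 0≤M) (identity ε M)
      where
      identity : ∀ ε M → (⟦ 9 ⟧ * (1/40 - ε) + + 31 / 40) * M ≡ - (⟦ 0 ⟧ - (1ℚ - ⟦ 9 ⟧ * ε) * M)
      identity = solve-∀ ℚ-ring

  confusable⇒0≤ε : ∀ ε M I → 0ℚ ≤ M → I ≤ M → (1ℚ - ⟦ 9 ⟧ * ε) * M < I → 0ℚ ≤ ε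
  confusable⇒0≤ε ε M I 0≤M I≤M M< with 0ℚ ℚₚ.≤? ε
  ... | yes 0≤ε = 0≤ε
  ... | no  0≰ε = contradiction
    (0≤* (0≤* (0≤⟦⟧ 9) (ℚₚ.<⇒≤ (p<q⇒0<q-p (ℚₚ.≰⇒> 0≰ε)))) 0≤M)
    (λ 0≤r → ⊥-by (0<+ (p<q⇒0<q-p M<) (p≤q⇒0≤q-p I≤M)) 0≤r (identity ε M I))
    where
    identity : ∀ ε M I → (⟦ 9 ⟧ * (0ℚ - ε)) * M ≡ - ((I - (1ℚ - ⟦ 9 ⟧ * ε) * M) + (M - I))
    identity = solve-∀ ℚ-ring

  ≤-sum₃ : ∀ ε X a b c → a ≤ ε * (⟦ 2 ⟧ * X) → b ≤ ε * (⟦ 2 ⟧ * X) → c ≤ ε * (⟦ 2 ⟧ * X) →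
           a + (b + (c + ⟦ 0 ⟧)) ≤ ⟦ 6 ⟧ * (ε * X)
  ≤-sum₃ ε X a b c a≤ b≤ c≤ =
    ≤-by (0≤+ (0≤+ (p≤q⇒0≤q-p a≤) (p≤q⇒0≤q-p b≤)) (p≤q⇒0≤q-p c≤)) (identity ε X a b c)
    where
    identity : ∀ ε X a b c →
      ((ε * (⟦ 2 ⟧ * X) - a) + (ε * (⟦ 2 ⟧ * X) - b)) + (ε * (⟦ 2 ⟧ * X) - c)
      ≡ ⟦ 6 ⟧ * (ε * X) - (a + (b + (c + ⟦ 0 ⟧)))
    identity = solve-∀ ℚ-ring

  ⟦⟧-≤-2* : ∀ a b → a ℕ.≤ 2 ℕ.* b → ⟦ a ⟧ ≤ ⟦ 2 ⟧ * ⟦ b ⟧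
  ⟦⟧-≤-2* a b a≤ = subst (⟦ a ⟧ ≤_) (⟦⟧-* 2 b) (⟦⟧-mono-≤ a≤)

  ⟦⟧-2*-≤-+ : ∀ a b c → 2 ℕ.* a ℕ.≤ b ℕ.+ c → ⟦ 2 ⟧ * ⟦ a ⟧ ≤ ⟦ b ⟧ + ⟦ c ⟧
  ⟦⟧-2*-≤-+ a b c ≤ = subst₂ _≤_ (⟦⟧-* 2 a) (⟦⟧-+ b c) (⟦⟧-mono-≤ ≤)

  ⟦⟧-≤-+ : ∀ a b c → a ℕ.≤ b ℕ.+ c → ⟦ a ⟧ ≤ ⟦ b ⟧ + ⟦ c ⟧
  ⟦⟧-≤-+ a b c ≤ = subst (⟦ a ⟧ ≤_) (⟦⟧-+ b c) (⟦⟧-mono-≤ ≤)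

  ⟦⟧-≤-+-+ : ∀ a b c d → a ℕ.≤ b ℕ.+ c ℕ.+ d → ⟦ a ⟧ ≤ ⟦ b ⟧ + ⟦ c ⟧ + ⟦ d ⟧
  ⟦⟧-≤-+-+ a b c d ≤ =
    subst (⟦ a ⟧ ≤_) (trans (⟦⟧-+ (b ℕ.+ c) d) (cong (_+ ⟦ d ⟧) (⟦⟧-+ b c))) (⟦⟧-mono-≤ ≤)

  ⟦⟧-≤-+-+-+ : ∀ a b c d e → a ℕ.≤ b ℕ.+ c ℕ.+ d ℕ.+ e → ⟦ a ⟧ ≤ ⟦ b ⟧ + ⟦ c ⟧ + ⟦ d ⟧ + ⟦ e ⟧
  ⟦⟧-≤-+-+-+ a b c d e ≤ =
    subst (⟦ a ⟧ ≤_) (trans (⟦⟧-+ (b ℕ.+ c ℕ.+ d) e) (cong (_+ ⟦ e ⟧) (trans (⟦⟧-+ (b ℕ.+ c) d)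
      (cong (_+ ⟦ d ⟧) (⟦⟧-+ b c))))) (⟦⟧-mono-≤ ≤)

  ⟦⟧-+-≤-+ : ∀ a b c d → a ℕ.+ b ℕ.≤ c ℕ.+ d → ⟦ a ⟧ + ⟦ b ⟧ ≤ ⟦ c ⟧ + ⟦ d ⟧
  ⟦⟧-+-≤-+ a b c d ≤ = subst₂ _≤_ (⟦⟧-+ a b) (⟦⟧-+ c d) (⟦⟧-mono-≤ ≤)

open Arithmetic

open import Data.Nat using (_+_; _*_; _≤_)
open import Algebra.Properties.CommutativeMonoid.Sum ℕₚ.+-0-commutativeMonoid
  using (sum-permute; ∑-distrib-+) renaming (sum to ∑)

indicator : Bool → ℕ
indicator b = if b then 1 else 0

sumFin-cong : ∀ {n} {f g : Fin n → ℕ} → (∀ i → f i ≡ g i) → sumFin f ≡ sumFin g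
sumFin-cong {zero}  f≗g = refl
sumFin-cong {suc n} f≗g = cong₂ _+_ (f≗g Fin.zero) (sumFin-cong (f≗g ∘ Fin.suc))

sumFin-mono : ∀ {n} {f g : Fin n → ℕ} → (∀ i → f i ≤ g i) → sumFin f ≤ sumFin g
sumFin-mono {zero}  f≤g = z≤n
sumFin-mono {suc n} f≤g = ℕₚ.+-mono-≤ (f≤g Fin.zero) (sumFin-mono (f≤g ∘ Fin.suc))

sumFin≡∑ : ∀ {n} (f : Fin n → ℕ) → sumFin f ≡ ∑ f
sumFin≡∑ {zero}  f = refl
sumFin≡∑ {suc n} f = cong (_+_ (f Fin.zero)) (sumFin≡∑ (f ∘ Fin.suc))

sumFin-+ : ∀ {n} (f g : Fin n → ℕ) → sumFin (λ i → f i + g i) ≡ sumFin f + sumFin g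
sumFin-+ f g = begin
  sumFin (λ i → f i + g i) ≡⟨ sumFin≡∑ (λ i → f i + g i) ⟩
  ∑ (λ i → f i + g i)      ≡⟨ ∑-distrib-+ f g ⟩
  ∑ f + ∑ g                ≡⟨ cong₂ _+_ (sumFin≡∑ f) (sumFin≡∑ g) ⟨
  sumFin f + sumFin g      ∎
  where open ≡-Reasoning

sumFin-*ʳ : ∀ {n} (f : Fin n → ℕ) k → sumFin (λ i → f i * k) ≡ sumFin f * k
sumFin-*ʳ {zero}  f k = refl
sumFin-*ʳ {suc n} f k = trans (cong (_+_ (f Fin.zero * k)) (sumFin-*ʳ (f ∘ Fin.suc) k))
                              (sym (ℕₚ.*-distribʳ-+ k (f Fin.zero) _))

sumFin-permute : ∀ {m n} (f : Fin n → ℕ) (π : Permutation m n) →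
                 sumFin f ≡ sumFin (f ∘ (π ⟨$⟩ʳ_))
sumFin-permute f π = begin
  sumFin f               ≡⟨ sumFin≡∑ f ⟩
  ∑ f                    ≡⟨ sum-permute f π ⟩
  ∑ (f ∘ (π ⟨$⟩ʳ_))      ≡⟨ sumFin≡∑ (f ∘ (π ⟨$⟩ʳ_)) ⟨
  sumFin (f ∘ (π ⟨$⟩ʳ_)) ∎
  where open ≡-Reasoning

sumFin-↑ : ∀ a {b} (f : Fin (a + b) → ℕ) →
           sumFin f ≡ sumFin (λ i → f (i ↑ˡ b)) + sumFin (λ j → f (a ↑ʳ j))
sumFin-↑ zero    f = refl
sumFin-↑ (suc a) f = trans (cong (_+_ (f Fin.zero)) (sumFin-↑ a (f ∘ Fin.suc)))
                           (sym (ℕₚ.+-assoc (f Fin.zero) _ _))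

sumFin-combine : ∀ a b (f : Fin (a * b) → ℕ) →
                 sumFin f ≡ sumFin (λ i → sumFin (λ j → f (combine {a} {b} i j)))
sumFin-combine zero    b f = refl
sumFin-combine (suc a) b f =
  trans (sumFin-↑ b f) (cong (_+_ (sumFin (λ j → f (j ↑ˡ (a * b))))) (sumFin-combine a b (f ∘ (b ↑ʳ_))))

module _ {n : ℕ} where

  count-cong : {f g : Fin n → Bool} → (∀ i → f i ≡ g i) → count f ≡ count g
  count-cong f≗g = sumFin-cong (cong indicator ∘ f≗g)

  count-mono : {f g : Fin n → Bool} → (∀ i → f i ≡ true → g i ≡ true) → count f ≤ count g
  count-mono {f} {g} f⇒g = sumFin-mono pointwise
    where
    pointwise : ∀ i → indicator (f i) ≤ indicator (g i)
    pointwise i with f i in fi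
    ... | false = z≤n
    ... | true rewrite f⇒g i fi = ℕₚ.≤-refl

  count-false : (f : Fin n → Bool) → (∀ i → f i ≡ false) → count f ≡ 0
  count-false f f≡false = trans (sumFin-cong (cong indicator ∘ f≡false)) (sumFin-zero n)
    where
    sumFin-zero : ∀ k → sumFin {k} (λ _ → 0) ≡ 0
    sumFin-zero zero    = refl
    sumFin-zero (suc k) = sumFin-zero k

  count-≤-+ : (f g h : Fin n → Bool) → (∀ i → indicator (f i) ≤ indicator (g i) + indicator (h i)) →
              count f ≤ count g + count h
  count-≤-+ f g h pointwise =
    subst (count f ≤_) (sumFin-+ (indicator ∘ g) (indicator ∘ h)) (sumFin-mono pointwise)

  count-+-≤-+ : (f g h k : Fin n → Bool) →
    (∀ i → indicator (f i) + indicator (g i) ≤ indicator (h i) + indicator (k i)) →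
    count f + count g ≤ count h + count k
  count-+-≤-+ f g h k pointwise =
    subst₂ _≤_ (sumFin-+ (indicator ∘ f) (indicator ∘ g)) (sumFin-+ (indicator ∘ h) (indicator ∘ k))
      (sumFin-mono pointwise)

  count-∨ : (f g : Fin n → Bool) → count (λ i → f i ∨ g i) ≤ count f + count g
  count-∨ f g = count-≤-+ (λ i → f i ∨ g i) f g (λ i → pointwise (f i) (g i))
    where
    pointwise : ∀ a b → indicator (a ∨ b) ≤ indicator a + indicator b
    pointwise false b = ℕₚ.≤-refl
    pointwise true  b = s≤s z≤n

  count-∧not : (f g : Fin n → Bool) → count f ≤ count (λ i → f i ∧ not (g i)) + count g
  count-∧not f g = count-≤-+ f (λ i → f i ∧ not (g i)) g (λ i → pointwise (f i) (g i))
    where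
    pointwise : ∀ a b → indicator a ≤ indicator (a ∧ not b) + indicator b
    pointwise false b     = z≤n
    pointwise true  false = s≤s z≤n
    pointwise true  true  = ℕₚ.≤-refl

  count-∧∧ : (f g h : Fin n → Bool) →
    count (λ i → f i ∧ g i) + count (λ i → f i ∧ h i) ≤ count (λ i → f i ∧ (g i ∧ h i)) + count f
  count-∧∧ f g h = count-+-≤-+ (λ i → f i ∧ g i) (λ i → f i ∧ h i) (λ i → f i ∧ (g i ∧ h i)) f
    (λ i → pointwise (f i) (g i) (h i))
    where
    pointwise : ∀ a b c → indicator (a ∧ b) + indicator (a ∧ c) ≤ indicator (a ∧ (b ∧ c)) + indicator a
    pointwise false b     c     = z≤n
    pointwise true  false false = z≤n
    pointwise true  false true  = ℕₚ.≤-refl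
    pointwise true  true  c     = ℕₚ.≤-reflexive (ℕₚ.+-comm 1 (indicator c))

count-witness : ∀ {n} (f : Fin n → Bool) → 0 ℕ.< count f → ∃ λ i → f i ≡ true
count-witness {suc n} f 0<count with f Fin.zero in f₀
... | true  = Fin.zero , f₀
... | false = let i , fi = count-witness (f ∘ Fin.suc) 0<count in Fin.suc i , fi

count-<-witness : ∀ {n} (f g : Fin n → Bool) → count f ℕ.< count g →
                  ∃ λ i → g i ∧ not (f i) ≡ true
count-<-witness f g f<g = count-witness (λ i → g i ∧ not (f i)) (ℕₚ.≰⇒> ≰)
  where
  ≰ : ¬ count (λ i → g i ∧ not (f i)) ≤ 0
  ≰ ≤0 = ℕₚ.<⇒≱ f<g (ℕₚ.≤-trans (count-∧not g f) (ℕₚ.+-monoˡ-≤ (count f) ≤0))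

anyFin : ∀ {k} → (Fin k → Bool) → Bool
anyFin {zero}  f = false
anyFin {suc k} f = f Fin.zero ∨ anyFin (f ∘ Fin.suc)

anyFin-false : ∀ {k} (f : Fin k → Bool) → anyFin f ≡ false → ∀ x → f x ≡ false
anyFin-false {suc k} f any≡false x with f Fin.zero in f₀
anyFin-false f any≡false Fin.zero    | false = f₀
anyFin-false f any≡false (Fin.suc x) | false = anyFin-false (f ∘ Fin.suc) any≡false x

count-anyFin : ∀ {k n} (F : Fin k → Fin n → Bool) →
               count (λ j → anyFin (λ x → F x j)) ≤ sumFin (λ x → count (F x))
count-anyFin {zero} {n} F = ℕₚ.≤-reflexive (count-false {n} (λ _ → false) (λ _ → refl))
count-anyFin {suc k} F = ℕₚ.≤-trans (count-∨ (F Fin.zero) _)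
  (ℕₚ.+-monoʳ-≤ (count (F Fin.zero)) (count-anyFin (F ∘ Fin.suc)))

module _ {n m : ℕ} {ψ : Fin n → PV m} (ψ-bij : Bijective _≡_ _≡_ ψ) where

  private
    ψ↔ : Fin n ↔ PV m
    ψ↔ = ⤖⇒↔ (mk⤖ ψ-bij)

    π : Permutation (3 * m) n
    π = ↔-trans Finₚ.*↔× (↔-sym ψ↔)

    ψ∘π : ∀ c → ψ (π ⟨$⟩ʳ c) ≡ remQuot m c
    ψ∘π c = Inverse.strictlyInverseˡ ψ↔ (remQuot m c)

  count-∘bijection : (f : PV m → Bool) → count (f ∘ ψ) ≡ countP f
  count-∘bijection f = begin
    count (f ∘ ψ)
      ≡⟨ sumFin-permute (indicator ∘ f ∘ ψ) π ⟩
    sumFin (λ c → indicator (f (ψ (π ⟨$⟩ʳ c))))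
      ≡⟨ sumFin-cong (λ c → cong (indicator ∘ f) (ψ∘π c)) ⟩
    sumFin (λ c → indicator (f (remQuot m c)))
      ≡⟨ sumFin-combine 3 m (λ c → indicator (f (remQuot m c))) ⟩
    sumFin (λ i → sumFin (λ j → indicator (f (remQuot m (combine {3} {m} i j)))))
      ≡⟨ sumFin-cong (λ i → sumFin-cong (λ j → cong (indicator ∘ f) (Finₚ.remQuot-combine {3} {m} i j))) ⟩
    countP f ∎
    where open ≡-Reasoning

countP-× : ∀ {m} (c : Fin 3 → Bool) (F : Fin m → Bool) →
           countP (λ p → c (proj₁ p) ∧ F (proj₂ p)) ≡ count c * count F
countP-× {m} c F = trans (sumFin-cong row) (sumFin-*ʳ (indicator ∘ c) (count F))
  where
  row : ∀ i → count (λ j → c i ∧ F j) ≡ indicator (c i) * count F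
  row i with c i
  ... | true  = sym (ℕₚ.+-identityʳ (count F))
  ... | false = count-false {m} (λ _ → false) (λ _ → refl)

other-colours : (k : Fin 3) → count (λ x → not ⌊ k Fin.≟ x ⌋) ≡ 2
other-colours 0F = refl
other-colours 1F = refl
other-colours 2F = refl

countP-other-colours : ∀ {m} (k : Fin 3) (F : Fin m → Bool) →
  countP (λ p → not ⌊ k Fin.≟ proj₁ p ⌋ ∧ F (proj₂ p)) ≡ 2 * count F
countP-other-colours k F = trans (countP-× (λ x → not ⌊ k Fin.≟ x ⌋) F) (cong (_* count F) (other-colours k))

third-colour : (k l : Fin 3) → k ≢ l → count (λ x → not ⌊ k Fin.≟ x ⌋ ∧ not ⌊ l Fin.≟ x ⌋) ≡ 1
third-colour 0F 1F _ = refl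
third-colour 0F 2F _ = refl
third-colour 1F 0F _ = refl
third-colour 1F 2F _ = refl
third-colour 2F 0F _ = refl
third-colour 2F 1F _ = refl
third-colour 0F 0F k≢l = contradiction refl k≢l
third-colour 1F 1F k≢l = contradiction refl k≢l
third-colour 2F 2F k≢l = contradiction refl k≢l

countP-cong : ∀ {m} {f g : PV m → Bool} → (∀ p → f p ≡ g p) → countP f ≡ countP g
countP-cong f≗g = sumFin-cong (λ i → count-cong (λ j → f≗g (i , j)))

∧-true⁻ : ∀ {a b} → a ∧ b ≡ true → a ≡ true × b ≡ true
∧-true⁻ {true} {true} _ = refl , refl

common-≤-deg : ∀ {n} (X : Graph n) g g′ → common X g g′ ≤ deg X g
common-≤-deg X g g′ = count-mono {f = λ w → adj X g w ∧ adj X g′ w} (λ w → proj₁ ∘ ∧-true⁻)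

-- Degrees in a graph near K₃ × G

module NearGraph {ε : ℚ} {m n : ℕ} {G : Graph m} {H : Graph n} (N : Near ε G H) where

  ψ⁻¹ : PV m → Fin n
  ψ⁻¹ p = proj₁ (proj₂ (ψ-bij N) p)

  ψ-injective : ∀ {u v} → ψ N u ≡ ψ N v → u ≡ v
  ψ-injective = proj₁ (ψ-bij N)

  ψ∘ψ⁻¹ : ∀ p → ψ N (ψ⁻¹ p) ≡ p
  ψ∘ψ⁻¹ p = proj₂ (proj₂ (ψ-bij N) p) refl

  ψ⁻¹∘ψ : ∀ v → ψ⁻¹ (ψ N v) ≡ v
  ψ⁻¹∘ψ v = ψ-injective (ψ∘ψ⁻¹ (ψ N v))

  ψ⁻¹-injective : ∀ {p q} → ψ⁻¹ p ≡ ψ⁻¹ q → p ≡ q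
  ψ⁻¹-injective {p} {q} ψ⁻¹p≡ψ⁻¹q = trans (sym (ψ∘ψ⁻¹ p)) (trans (cong (ψ N) ψ⁻¹p≡ψ⁻¹q) (ψ∘ψ⁻¹ q))

  Hadj : PV m → PV m → Bool
  Hadj p q = Padj G p q ∧ not (E' N p q)

  removed : PV m → ℕ
  removed p = countP (E' N p)

  count-∘ψ : (f : PV m → Bool) → count (f ∘ ψ N) ≡ countP f
  count-∘ψ = count-∘bijection (ψ-bij N)

  degP≡ : ∀ p → degP G p ≡ 2 * deg G (proj₂ p)
  degP≡ (k , g) = countP-other-colours k (adj G g)

  deg≡ : ∀ u → deg H u ≡ count (λ w → Hadj (ψ N u) (ψ N w))
  deg≡ u = count-cong (iso N u)

  common≡ : ∀ u v → common H u v ≡ count (λ w → Hadj (ψ N u) (ψ N w) ∧ Hadj (ψ N v) (ψ N w))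
  common≡ u v = count-cong (λ w → cong₂ _∧_ (iso N u w) (iso N v w))

  deg-≤ : ∀ u → deg H u ≤ 2 * deg G (ψG N u)
  deg-≤ u = begin
    deg H u                                  ≡⟨ deg≡ u ⟩
    count (λ w → Hadj (ψ N u) (ψ N w))
      ≤⟨ count-mono {f = λ w → Hadj (ψ N u) (ψ N w)} (λ w → proj₁ ∘ ∧-true⁻) ⟩
    count (λ w → Padj G (ψ N u) (ψ N w))     ≡⟨ count-∘ψ (Padj G (ψ N u)) ⟩
    degP G (ψ N u)                           ≡⟨ degP≡ (ψ N u) ⟩
    2 * deg G (ψG N u)                       ∎
    where open ℕₚ.≤-Reasoning

  deg-≥ : ∀ u → 2 * deg G (ψG N u) ≤ deg H u + removed (ψ N u)
  deg-≥ u = begin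
    2 * deg G (ψG N u)                       ≡⟨ degP≡ (ψ N u) ⟨
    degP G (ψ N u)                           ≡⟨ count-∘ψ (Padj G (ψ N u)) ⟨
    count (λ w → Padj G (ψ N u) (ψ N w))     ≤⟨ count-∧not _ (λ w → E' N (ψ N u) (ψ N w)) ⟩
    count (λ w → Hadj (ψ N u) (ψ N w)) + count (λ w → E' N (ψ N u) (ψ N w))
      ≡⟨ cong₂ _+_ (deg≡ u) (sym (count-∘ψ (E' N (ψ N u)))) ⟨
    deg H u + removed (ψ N u)                ∎
    where open ℕₚ.≤-Reasoning

  common-≤ : ∀ u v → common H u v ≤ 2 * common G (ψG N u) (ψG N v)
  common-≤ u v = begin
    common H u v                             ≡⟨ common≡ u v ⟩
    count (λ w → Hadj (ψ N u) (ψ N w) ∧ Hadj (ψ N v) (ψ N w))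
      ≤⟨ count-mono {f = λ w → Hadj (ψ N u) (ψ N w) ∧ Hadj (ψ N v) (ψ N w)} (λ w → both-edges (ψ N w)) ⟩
    count (λ w → F (ψ N w))                  ≡⟨ count-∘ψ F ⟩
    countP F
      ≡⟨ countP-other-colours (ψK N u) (λ j → adj G (ψG N u) j ∧ adj G (ψG N v) j) ⟩
    2 * common G (ψG N u) (ψG N v)           ∎
    where
    open ℕₚ.≤-Reasoning
    F : PV m → Bool
    F p = not ⌊ ψK N u Fin.≟ proj₁ p ⌋ ∧ (adj G (ψG N u) (proj₂ p) ∧ adj G (ψG N v) (proj₂ p))
    both-edges : ∀ p → Hadj (ψ N u) p ∧ Hadj (ψ N v) p ≡ true → F p ≡ true
    both-edges p = table (not ⌊ ψK N u Fin.≟ proj₁ p ⌋) (adj G (ψG N u) (proj₂ p)) (E' N (ψ N u) p)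
                         (not ⌊ ψK N v Fin.≟ proj₁ p ⌋) (adj G (ψG N v) (proj₂ p)) (E' N (ψ N v) p)
      where
      table : ∀ c a e c′ a′ e′ → ((c ∧ a) ∧ not e) ∧ ((c′ ∧ a′) ∧ not e′) ≡ true → c ∧ (a ∧ a′) ≡ true
      table true true false true true false _ = refl

  removed-≤ : ∀ p → ⟦ removed p ⟧ ℚ.≤ ε ℚ.* (⟦ 2 ⟧ ℚ.* ⟦ deg G (proj₂ p) ⟧)
  removed-≤ p = subst (λ z → ⟦ removed p ⟧ ℚ.≤ ε ℚ.* z)
    (trans (cong ⟦_⟧ (degP≡ p)) (⟦⟧-* 2 (deg G (proj₂ p)))) (E'-small N p)

  module _ {u v : Fin n} {g : Fin m} (ψGu≡g : ψG N u ≡ g) (ψGv≡g : ψG N v ≡ g)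
           (ψKu≢ψKv : ψK N u ≢ ψK N v) where

    private
      F : PV m → Bool
      F p = Padj G (ψ N u) p ∧ Padj G (ψ N v) p

      countP-F : countP F ≡ deg G g
      countP-F = begin
        countP F
          ≡⟨ countP-cong (λ p → regroup (not ⌊ ψK N u Fin.≟ proj₁ p ⌋) (not ⌊ ψK N v Fin.≟ proj₁ p ⌋)
                                       (cong (λ h → adj G h (proj₂ p)) ψGu≡g)
                                       (cong (λ h → adj G h (proj₂ p)) ψGv≡g)) ⟩
        countP (λ p → (not ⌊ ψK N u Fin.≟ proj₁ p ⌋ ∧ not ⌊ ψK N v Fin.≟ proj₁ p ⌋) ∧ adj G g (proj₂ p))
          ≡⟨ countP-× (λ x → not ⌊ ψK N u Fin.≟ x ⌋ ∧ not ⌊ ψK N v Fin.≟ x ⌋) (adj G g) ⟩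
        count (λ x → not ⌊ ψK N u Fin.≟ x ⌋ ∧ not ⌊ ψK N v Fin.≟ x ⌋) * deg G g
          ≡⟨ cong (_* deg G g) (third-colour (ψK N u) (ψK N v) ψKu≢ψKv) ⟩
        1 * deg G g
          ≡⟨ ℕₚ.*-identityˡ (deg G g) ⟩
        deg G g ∎
        where
        open ≡-Reasoning
        regroup : ∀ a c {b₁ b₂ b} → b₁ ≡ b → b₂ ≡ b → (a ∧ b₁) ∧ (c ∧ b₂) ≡ (a ∧ c) ∧ b
        regroup false c                 refl refl = refl
        regroup true  false {b = false} refl refl = refl
        regroup true  false {b = true}  refl refl = refl
        regroup true  true  {b = false} refl refl = refl
        regroup true  true  {b = true}  refl refl = refl

    fibre-common-≤ : common H u v ≤ deg G g
    fibre-common-≤ = begin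
      common H u v                               ≡⟨ common≡ u v ⟩
      count (λ w → Hadj (ψ N u) (ψ N w) ∧ Hadj (ψ N v) (ψ N w))
        ≤⟨ count-mono {f = λ w → Hadj (ψ N u) (ψ N w) ∧ Hadj (ψ N v) (ψ N w)} (λ w → drop-removed (ψ N w)) ⟩
      count (λ w → F (ψ N w))                    ≡⟨ count-∘ψ F ⟩
      countP F                                   ≡⟨ countP-F ⟩
      deg G g                                    ∎
      where
      open ℕₚ.≤-Reasoning
      drop-removed : ∀ p → Hadj (ψ N u) p ∧ Hadj (ψ N v) p ≡ true → F p ≡ true
      drop-removed p = table (Padj G (ψ N u) p) (E' N (ψ N u) p) (Padj G (ψ N v) p) (E' N (ψ N v) p)
        where
        table : ∀ a e a′ e′ → (a ∧ not e) ∧ (a′ ∧ not e′) ≡ true → a ∧ a′ ≡ true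
        table true false true false _ = refl

    fibre-common-≥ : deg G g ≤ common H u v + removed (ψ N u) + removed (ψ N v)
    fibre-common-≥ = begin
      deg G g                                    ≡⟨ countP-F ⟨
      countP F                                   ≡⟨ count-∘ψ F ⟨
      count (λ w → F (ψ N w))                    ≤⟨ count-∧not (λ w → F (ψ N w)) R ⟩
      count (λ w → F (ψ N w) ∧ not (R w)) + count R
        ≤⟨ ℕₚ.+-mono-≤ (count-mono {f = λ w → F (ψ N w) ∧ not (R w)} (λ w → keep-edges (ψ N w)))
                        (count-∨ (λ w → E' N (ψ N u) (ψ N w)) (λ w → E' N (ψ N v) (ψ N w))) ⟩
      count (λ w → Hadj (ψ N u) (ψ N w) ∧ Hadj (ψ N v) (ψ N w))
        + (count (λ w → E' N (ψ N u) (ψ N w)) + count (λ w → E' N (ψ N v) (ψ N w)))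
        ≡⟨ cong₂ _+_ (sym (common≡ u v)) (cong₂ _+_ (count-∘ψ (E' N (ψ N u))) (count-∘ψ (E' N (ψ N v)))) ⟩
      common H u v + (removed (ψ N u) + removed (ψ N v))
        ≡⟨ ℕₚ.+-assoc (common H u v) _ _ ⟨
      common H u v + removed (ψ N u) + removed (ψ N v) ∎
      where
      open ℕₚ.≤-Reasoning
      R : Fin n → Bool
      R w = E' N (ψ N u) (ψ N w) ∨ E' N (ψ N v) (ψ N w)
      keep-edges : ∀ p → F p ∧ not (E' N (ψ N u) p ∨ E' N (ψ N v) p) ≡ true →
                   Hadj (ψ N u) p ∧ Hadj (ψ N v) p ≡ true
      keep-edges p = table (Padj G (ψ N u) p) (Padj G (ψ N v) p) (E' N (ψ N u) p) (E' N (ψ N v) p)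
        where
        table : ∀ a a′ e e′ → (a ∧ a′) ∧ not (e ∨ e′) ≡ true → (a ∧ not e) ∧ (a′ ∧ not e′) ≡ true
        table true true false false _ = refl

  Linked : Fin m → Fin m → Set
  Linked g h = adj G g h ≡ true × (∀ x y → E' N (x , g) (y , h) ≡ false)

  LinkedTo : Fin n → Fin m → Set
  LinkedTo v h = adj G (ψG N v) h ≡ true × (∀ y → E' N (ψ N v) (y , h) ≡ false)

  Linked-sym : ∀ {g h} → Linked g h → Linked h g
  Linked-sym {g} {h} (gh , clean) =
    trans (Graph.sym G h g) gh , λ x y → trans (E'-sym N (x , h) (y , g)) (clean y x)

  dirtyTo : PV m → Fin m → Bool
  dirtyTo p h = anyFin (λ y → E' N p (y , h))

  dirty : Fin m → Fin m → Bool
  dirty g h = anyFin (λ x → dirtyTo (x , g) h)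

  fibreRemoved : Fin m → ℕ
  fibreRemoved g = sumFin (λ x → removed (x , g))

  count-dirtyTo : ∀ p → count (dirtyTo p) ≤ removed p
  count-dirtyTo p = count-anyFin (λ y h → E' N p (y , h))

  count-dirty : ∀ g → count (dirty g) ≤ fibreRemoved g
  count-dirty g = ℕₚ.≤-trans (count-anyFin (λ x → dirtyTo (x , g))) (sumFin-mono (λ x → count-dirtyTo (x , g)))

  fibreRemoved-≤ : ∀ g → ⟦ fibreRemoved g ⟧ ℚ.≤ ⟦ 6 ⟧ ℚ.* (ε ℚ.* ⟦ deg G g ⟧)
  fibreRemoved-≤ g = subst (ℚ._≤ ⟦ 6 ⟧ ℚ.* (ε ℚ.* ⟦ deg G g ⟧))
    (sym (trans (⟦⟧-+ (removed (0F , g)) _) (cong (⟦ removed (0F , g) ⟧ ℚ.+_)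
      (trans (⟦⟧-+ (removed (1F , g)) _) (cong (⟦ removed (1F , g) ⟧ ℚ.+_) (⟦⟧-+ (removed (2F , g)) 0))))))
    (≤-sum₃ ε ⟦ deg G g ⟧ _ _ _ (removed-≤ (0F , g)) (removed-≤ (1F , g)) (removed-≤ (2F , g)))

  dirty-false : ∀ {g h} → dirty g h ≡ false → ∀ x y → E' N (x , g) (y , h) ≡ false
  dirty-false {g} {h} clean x = anyFin-false _ (anyFin-false (λ x → dirtyTo (x , g) h) clean x)

  dirtyTo-false : ∀ {v h} → dirtyTo (ψ N v) h ≡ false → ∀ y → E' N (ψ N v) (y , h) ≡ false
  dirtyTo-false {v} {h} = anyFin-false (λ y → E' N (ψ N v) (y , h))

  dirtyAround : Fin n → Fin n → Fin n → Fin m → Bool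
  dirtyAround v₁ v₂ v₃ h = dirtyTo (ψ N v₁) h ∨ (dirtyTo (ψ N v₂) h ∨ (dirtyTo (ψ N v₃) h ∨ dirty (ψG N v₁) h))

  count-dirtyAround : ∀ v₁ v₂ v₃ →
    count (dirtyAround v₁ v₂ v₃) ≤ removed (ψ N v₁) + removed (ψ N v₂) + removed (ψ N v₃) + fibreRemoved (ψG N v₁)
  count-dirtyAround v₁ v₂ v₃ = begin
    count (dirtyAround v₁ v₂ v₃)
      ≤⟨ ℕₚ.≤-trans (count-∨ (dirtyTo (ψ N v₁)) _) (ℕₚ.+-monoʳ-≤ _
         (ℕₚ.≤-trans (count-∨ (dirtyTo (ψ N v₂)) _) (ℕₚ.+-monoʳ-≤ _
           (count-∨ (dirtyTo (ψ N v₃)) (dirty (ψG N v₁)))))) ⟩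
    count (dirtyTo (ψ N v₁)) + (count (dirtyTo (ψ N v₂)) + (count (dirtyTo (ψ N v₃)) + count (dirty (ψG N v₁))))
      ≤⟨ ℕₚ.+-mono-≤ (count-dirtyTo (ψ N v₁)) (ℕₚ.+-mono-≤ (count-dirtyTo (ψ N v₂))
           (ℕₚ.+-mono-≤ (count-dirtyTo (ψ N v₃)) (count-dirty (ψG N v₁)))) ⟩
    r₁ + (r₂ + (r₃ + fibreRemoved (ψG N v₁)))
      ≡⟨ trans (ℕₚ.+-assoc (r₁ + r₂) r₃ _) (ℕₚ.+-assoc r₁ r₂ _) ⟨
    r₁ + r₂ + r₃ + fibreRemoved (ψG N v₁) ∎
    where
    open ℕₚ.≤-Reasoning
    r₁ r₂ r₃ : ℕ
    r₁ = removed (ψ N v₁)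
    r₂ = removed (ψ N v₂)
    r₃ = removed (ψ N v₃)

  module Small (0≤ε : ℚ.0ℚ ℚ.≤ ε) (ε≤1/40 : ε ℚ.≤ 1/40) where
    open Estimates 0≤ε ε≤1/40

    fibre-pair-CandCond : ∀ {u v g} → ψG N u ≡ g → ψG N v ≡ g → ψK N u ≢ ψK N v → CandCond ε H u v
    fibre-pair-CandCond {u} {v} {g} refl ψGv≡g ψKu≢ψKv =
      fibre-pair-candidate ⟦ deg G g ⟧ ⟦ deg H u ⟧ ⟦ deg H v ⟧ ⟦ removed (ψ N u) ⟧ ⟦ removed (ψ N v) ⟧
        ⟦ common H u v ⟧ (0≤⟦⟧ (deg G g))
        (⟦⟧-≤-2* (deg H u) (deg G g) (deg-≤ u))
        (⟦⟧-2*-≤-+ (deg G g) (deg H u) (removed (ψ N u)) (deg-≥ u))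
        (⟦⟧-2*-≤-+ (deg G g) (deg H v) (removed (ψ N v))
          (subst (λ h → 2 * deg G h ≤ deg H v + removed (ψ N v)) ψGv≡g (deg-≥ v)))
        (removed-≤ (ψ N u))
        (subst (λ h → ⟦ removed (ψ N v) ⟧ ℚ.≤ ε ℚ.* (⟦ 2 ⟧ ℚ.* ⟦ deg G h ⟧)) ψGv≡g (removed-≤ (ψ N v)))
        (⟦⟧-≤-+-+ (deg G g) (common H u v) (removed (ψ N u)) (removed (ψ N v))
          (fibre-common-≥ refl ψGv≡g ψKu≢ψKv))
        (⟦⟧-mono-≤ (fibre-common-≤ refl ψGv≡g ψKu≢ψKv))

    fibre-deg-pos : ∀ u → 0 ℕ.< deg G (ψG N u) → 0 ℕ.< deg H u
    fibre-deg-pos u 0<d = ℕₚ.n≢0⇒n>0 λ deg≡0 →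
      fibre-degree-gap ⟦ deg G (ψG N u) ⟧ ⟦ removed (ψ N u) ⟧ (⟦⟧-mono-< 0<d)
        (⟦⟧-2*-≤-+ (deg G (ψG N u)) 0 (removed (ψ N u))
          (subst (λ k → 2 * deg G (ψG N u) ≤ k + removed (ψ N u)) deg≡0 (deg-≥ u)))
        (removed-≤ (ψ N u))

    candidate-deg-pos : ∀ {u v} → CAdj ε H u v → 0 ℕ.< deg H u → 0 ℕ.< deg H v
    candidate-deg-pos {u} {v} (_ , cond , _) 0<du = ℕₚ.n≢0⇒n>0 λ deg≡0 →
      candidate-degree-gap ⟦ deg H u ⟧ (⟦⟧-mono-< 0<du)
        (subst (λ k → ⟦ deg H u ⟧ ℚ.- ⟦ k ⟧ ℚ.≤ (⟦ 2 ⟧ ℚ.* ε) ℚ.* ⟦ deg H u ⟧) deg≡0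
          (proj₁ (cond (subst (_≤ deg H u) (sym deg≡0) z≤n))))

    confusable-deg-pos : ∀ g g′ → Confusable ε G g g′ → 0 ℕ.< deg G g
    confusable-deg-pos g g′ conf = ℕₚ.n≢0⇒n>0 λ deg≡0 →
      confusable-gap ⟦ deg G g ℕ.⊔ deg G g′ ⟧ (0≤⟦⟧ (deg G g ℕ.⊔ deg G g′))
        (subst (λ k → (ℚ.1ℚ ℚ.- ⟦ 9 ⟧ ℚ.* ε) ℚ.* ⟦ deg G g ℕ.⊔ deg G g′ ⟧ ℚ.< ⟦ k ⟧) (common≡0 deg≡0) conf)
      where
      common≡0 : deg G g ≡ 0 → common G g g′ ≡ 0
      common≡0 deg≡0 = ℕₚ.n≤0⇒n≡0 (subst (common G g g′ ≤_) deg≡0 (common-≤-deg G g g′))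

    CandCond-neighbour : ∀ {u v} → CandCond ε H u v → deg H v ≤ deg H u → 0 ℕ.< deg H u →
                         ∃ λ h → Linked (ψG N u) h × Linked (ψG N v) h
    CandCond-neighbour {u} {v} (_ , common≥ , _) dv≤du 0<du =
      let h , good = count-<-witness bad both few-dirty
          au , av , du , dv = decode (adj G gu h) (adj G gv h) (dirty gu h) (dirty gv h) good
      in h , (au , dirty-false du) , (av , dirty-false dv)
      where
      gu gv : Fin m
      gu = ψG N u
      gv = ψG N v
      both bad : Fin m → Bool
      both h = adj G gu h ∧ adj G gv h
      bad  h = dirty gu h ∨ dirty gv h
      few-dirty : count bad ℕ.< count both
      few-dirty = ⟦⟧-cancel-< (candidate-few-dirty
        ⟦ deg H u ⟧ ⟦ deg H v ⟧ ⟦ common H u v ⟧ ⟦ common G gu gv ⟧ ⟦ deg G gu ⟧ ⟦ deg G gv ⟧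
        ⟦ removed (ψ N u) ⟧ ⟦ removed (ψ N v) ⟧ ⟦ count bad ⟧ ⟦ fibreRemoved gu ⟧ ⟦ fibreRemoved gv ⟧
        (⟦⟧-mono-< 0<du) (0≤⟦⟧ (deg G gu)) (0≤⟦⟧ (deg G gv))
        common≥ (⟦⟧-≤-2* (common H u v) (common G gu gv) (common-≤ u v))
        (⟦⟧-2*-≤-+ (deg G gu) (deg H u) (removed (ψ N u)) (deg-≥ u)) (removed-≤ (ψ N u))
        (⟦⟧-2*-≤-+ (deg G gv) (deg H v) (removed (ψ N v)) (deg-≥ v)) (removed-≤ (ψ N v))
        (⟦⟧-mono-≤ dv≤du)
        (⟦⟧-≤-+ (count bad) (fibreRemoved gu) (fibreRemoved gv)
          (ℕₚ.≤-trans (count-∨ (dirty gu) (dirty gv)) (ℕₚ.+-mono-≤ (count-dirty gu) (count-dirty gv))))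
        (fibreRemoved-≤ gu) (fibreRemoved-≤ gv))
      decode : ∀ a b c d → (a ∧ b) ∧ not (c ∨ d) ≡ true →
               a ≡ true × b ≡ true × c ≡ false × d ≡ false
      decode true true false false _ = refl , refl , refl , refl

    CAdj-neighbour : ∀ {u v} → CAdj ε H u v → 0 ℕ.< deg H u →
                     ∃ λ h → Linked (ψG N u) h × Linked (ψG N v) h
    CAdj-neighbour {u} {v} cadj@(_ , cond , cond′) 0<du with deg H v ℕₚ.≤? deg H u
    ... | yes dv≤du = CandCond-neighbour (cond dv≤du) dv≤du 0<du
    ... | no  dv≰du =
      let du≤dv = ℕₚ.<⇒≤ (ℕₚ.≰⇒> dv≰du)
          h , linked-v , linked-u = CandCond-neighbour (cond′ du≤dv) du≤dv (candidate-deg-pos cadj 0<du)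
      in h , linked-u , linked-v

    quasi-core-neighbour : ∀ v₁ v₂ v₃ →
      Confusable ε G (ψG N v₁) (ψG N v₂) → Confusable ε G (ψG N v₁) (ψG N v₃) →
      ∃ λ h → Linked (ψG N v₁) h × LinkedTo v₁ h × LinkedTo v₂ h × LinkedTo v₃ h
    quasi-core-neighbour v₁ v₂ v₃ conf₂ conf₃ =
      let h , good = count-<-witness bad all-three few-dirty
          a₁ , a₂ , a₃ , b₁ , b₂ , b₃ , b = decode (adj G g₁ h) (adj G g₂ h) (adj G g₃ h)
            (dirtyTo (ψ N v₁) h) (dirtyTo (ψ N v₂) h) (dirtyTo (ψ N v₃) h) (dirty g₁ h) good
      in h , (a₁ , dirty-false b) , (a₁ , dirtyTo-false b₁) , (a₂ , dirtyTo-false b₂) , (a₃ , dirtyTo-false b₃)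
      where
      g₁ g₂ g₃ : Fin m
      g₁ = ψG N v₁
      g₂ = ψG N v₂
      g₃ = ψG N v₃
      r₁ r₂ r₃ : ℕ
      r₁ = removed (ψ N v₁)
      r₂ = removed (ψ N v₂)
      r₃ = removed (ψ N v₃)
      all-three bad : Fin m → Bool
      all-three h = adj G g₁ h ∧ (adj G g₂ h ∧ adj G g₃ h)
      bad = dirtyAround v₁ v₂ v₃
      few-dirty : count bad ℕ.< count all-three
      few-dirty = ⟦⟧-cancel-< (quasi-core-few-dirty
        ⟦ count all-three ⟧ ⟦ deg G g₁ ⟧ ⟦ deg G g₂ ⟧ ⟦ deg G g₃ ⟧
        ⟦ deg G g₁ ℕ.⊔ deg G g₂ ⟧ ⟦ deg G g₁ ℕ.⊔ deg G g₃ ⟧ ⟦ common G g₁ g₂ ⟧ ⟦ common G g₁ g₃ ⟧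
        ⟦ r₁ ⟧ ⟦ r₂ ⟧ ⟦ r₃ ⟧ ⟦ fibreRemoved g₁ ⟧ ⟦ count bad ⟧
        (0≤⟦⟧ (deg G g₁ ℕ.⊔ deg G g₂)) (0≤⟦⟧ (deg G g₁ ℕ.⊔ deg G g₃))
        (⟦⟧-+-≤-+ (common G g₁ g₂) (common G g₁ g₃) (count all-three) (deg G g₁)
          (count-∧∧ (adj G g₁) (adj G g₂) (adj G g₃)))
        conf₂ conf₃
        (⟦⟧-mono-≤ (ℕₚ.m≤m⊔n (deg G g₁) (deg G g₂))) (⟦⟧-mono-≤ (ℕₚ.m≤n⊔m (deg G g₁) (deg G g₂)))
        (⟦⟧-mono-≤ (ℕₚ.m≤m⊔n (deg G g₁) (deg G g₃))) (⟦⟧-mono-≤ (ℕₚ.m≤n⊔m (deg G g₁) (deg G g₃)))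
        (⟦⟧-≤-+-+-+ (count bad) r₁ r₂ r₃ (fibreRemoved g₁) (count-dirtyAround v₁ v₂ v₃))
        (removed-≤ (ψ N v₁)) (removed-≤ (ψ N v₂)) (removed-≤ (ψ N v₃)) (fibreRemoved-≤ g₁))
      decode : ∀ a₁ a₂ a₃ b₁ b₂ b₃ b → (a₁ ∧ (a₂ ∧ a₃)) ∧ not (b₁ ∨ (b₂ ∨ (b₃ ∨ b))) ≡ true →
        a₁ ≡ true × a₂ ≡ true × a₃ ≡ true × b₁ ≡ false × b₂ ≡ false × b₃ ≡ false × b ≡ false
      decode true true true false false false false _ = refl , refl , refl , refl , refl , refl , refl

injective⇒surjective : ∀ {k} (f : Fin k → Fin k) → (∀ {i j} → f i ≡ f j → i ≡ j) →
                       ∀ y → ∃ λ x → f x ≡ y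
injective⇒surjective {suc k} f f-inj y with Finₚ.any? (λ x → f x Fin.≟ y)
... | yes hit = hit
... | no  miss = ⊥-elim (Finₚ.<⇒notInjective {f = λ x → Fin.punchOut (y≢f x)} ℕₚ.≤-refl punched-injective)
  where
  y≢f : ∀ x → y ≢ f x
  y≢f x y≡fx = miss (x , sym y≡fx)
  punched-injective : ∀ {i j} → Fin.punchOut (y≢f i) ≡ Fin.punchOut (y≢f j) → i ≡ j
  punched-injective = f-inj ∘ Finₚ.punchOut-injective (y≢f _) (y≢f _)

corner : ∀ {n} → Triple n → Fin 3 → Fin n
corner (x , y , z) 0F = x
corner (x , y , z) 1F = y
corner (x , y , z) 2F = z

corner-Indexing : ∀ {n} (t : Triple n) → Indexing t (corner t)
corner-Indexing t = ∈t , ∈⇒corner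
  where
  ∈t : ∀ i → corner t i ∈T t
  ∈t 0F = inj₁ refl
  ∈t 1F = inj₂ (inj₁ refl)
  ∈t 2F = inj₂ (inj₂ refl)
  ∈⇒corner : ∀ v → v ∈T t → ∃ λ i → corner t i ≡ v
  ∈⇒corner v (inj₁ v≡x)        = 0F , sym v≡x
  ∈⇒corner v (inj₂ (inj₁ v≡y)) = 1F , sym v≡y
  ∈⇒corner v (inj₂ (inj₂ v≡z)) = 2F , sym v≡z

∈T-∀ : ∀ {n} (P : Fin n → Set) {x y z} → P x → P y → P z → ∀ {w} → w ∈T (x , y , z) → P w
∈T-∀ P px py pz (inj₁ refl)        = px
∈T-∀ P px py pz (inj₂ (inj₁ refl)) = py
∈T-∀ P px py pz (inj₂ (inj₂ refl)) = pz

corner-injective : ∀ {n} {A : Set} (f : Fin n → A) {x y z} →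
  f x ≢ f y → f x ≢ f z → f y ≢ f z →
  ∀ {i j} → f (corner (x , y , z) i) ≡ f (corner (x , y , z) j) → i ≡ j
corner-injective f x≢y x≢z y≢z {0F} {0F} _ = refl
corner-injective f x≢y x≢z y≢z {1F} {1F} _ = refl
corner-injective f x≢y x≢z y≢z {2F} {2F} _ = refl
corner-injective f x≢y x≢z y≢z {0F} {1F} e = contradiction e x≢y
corner-injective f x≢y x≢z y≢z {0F} {2F} e = contradiction e x≢z
corner-injective f x≢y x≢z y≢z {1F} {2F} e = contradiction e y≢z
corner-injective f x≢y x≢z y≢z {1F} {0F} e = contradiction (sym e) x≢y
corner-injective f x≢y x≢z y≢z {2F} {0F} e = contradiction (sym e) x≢z
corner-injective f x≢y x≢z y≢z {2F} {1F} e = contradiction (sym e) y≢z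

swap₁₂ : ∀ {A B C : Set} → A ⊎ B ⊎ C → B ⊎ A ⊎ C
swap₁₂ = [ inj₂ ∘ inj₁ , [ inj₁ , inj₂ ∘ inj₂ ]′ ]′

swap₂₃ : ∀ {A B C : Set} → A ⊎ B ⊎ C → A ⊎ C ⊎ B
swap₂₃ = [ inj₁ , [ inj₂ ∘ inj₂ , inj₂ ∘ inj₁ ]′ ]′

sort : ∀ {n} {a b c : Fin n} → a ≢ b → a ≢ c → b ≢ c →
       Σ (Triple n) λ t → Sorted t × (∀ v → (v ∈T t) ⇔ (v ∈T (a , b , c)))
sort {a = a} {b} {c} a≢b a≢c b≢c with Finₚ.<-cmp a b | Finₚ.<-cmp b c | Finₚ.<-cmp a c
... | tri≈ _ a≡b _ | _            | _            = contradiction a≡b a≢b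
... | _            | tri≈ _ b≡c _ | _            = contradiction b≡c b≢c
... | _            | _            | tri≈ _ a≡c _ = contradiction a≡c a≢c
... | tri< a<b _ _ | tri< b<c _ _ | _            = (a , b , c) , (a<b , b<c) , λ _ → mk⇔ id id
... | tri< a<b _ _ | tri> _ _ c<b | tri< a<c _ _ = (a , c , b) , (a<c , c<b) , λ _ → mk⇔ swap₂₃ swap₂₃
... | tri< a<b _ _ | tri> _ _ c<b | tri> _ _ c<a = (c , a , b) , (c<a , a<b) ,
                                                   λ _ → mk⇔ (swap₂₃ ∘ swap₁₂) (swap₁₂ ∘ swap₂₃)
... | tri> _ _ b<a | tri< b<c _ _ | tri< a<c _ _ = (b , a , c) , (b<a , a<c) , λ _ → mk⇔ swap₁₂ swap₁₂
... | tri> _ _ b<a | tri< b<c _ _ | tri> _ _ c<a = (b , c , a) , (b<c , c<a) ,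
                                                   λ _ → mk⇔ (swap₁₂ ∘ swap₂₃) (swap₂₃ ∘ swap₁₂)
... | tri> _ _ b<a | tri> _ _ c<b | _            = (c , b , a) , (c<b , b<a) ,
                                                   λ _ → mk⇔ (swap₁₂ ∘ swap₂₃ ∘ swap₁₂) (swap₁₂ ∘ swap₂₃ ∘ swap₁₂)

not-⌊≟⌋⇔≢ : ∀ {k} (a b : Fin k) → (not ⌊ a Fin.≟ b ⌋ ≡ true) ⇔ (a ≢ b)
not-⌊≟⌋⇔≢ a b with a Fin.≟ b
... | yes a≡b = mk⇔ (λ ()) (λ a≢b → contradiction a≡b a≢b)
... | no  a≢b = mk⇔ (λ _ → a≢b) (λ _ → refl)

module CoreTriangles {ε : ℚ} {m n : ℕ} {G : Graph m} {H : Graph n} (N : Near ε G H) where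
  open NearGraph N

  ψ⁻¹-fibre : ∀ {v g} → ψG N v ≡ g → ψ⁻¹ (ψK N v , g) ≡ v
  ψ⁻¹-fibre {v} refl = ψ⁻¹∘ψ v

  module _ {g : Fin m} {t : Triple n} (core : IsCoreTriangle N g t) where

    core-ψG : ∀ {v} → v ∈T t → ψG N v ≡ g
    core-ψG {v} = Equivalence.to (proj₂ core v)

    core-∈ : ∀ {v} → ψG N v ≡ g → v ∈T t
    core-∈ {v} = Equivalence.from (proj₂ core v)

    core-Indexing : (c : Fin 3 → Fin 3) → (∀ {i j} → c i ≡ c j → i ≡ j) →
                    Indexing t (λ j → ψ⁻¹ (c j , g))
    core-Indexing c c-injective =
      (λ j → core-∈ (cong proj₂ (ψ∘ψ⁻¹ (c j , g)))) , λ w w∈t →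
        let j , cj≡ψKw = injective⇒surjective c c-injective (ψK N w)
        in j , trans (cong (λ k → ψ⁻¹ (k , g)) cj≡ψKw) (ψ⁻¹-fibre (core-ψG w∈t))

  coreTriangle : ∀ g → Σ (Triple n) (IsCoreTriangle N g)
  coreTriangle g =
    let t , sorted , t≈abc = sort (colours-differ λ ()) (colours-differ λ ()) (colours-differ λ ())
    in t , sorted , λ v → mk⇔ (to ∘ Equivalence.to (t≈abc v))
                              (Equivalence.from (t≈abc v) ∘ λ ψGv≡g → subst (_∈T abc) (ψ⁻¹-fibre ψGv≡g) (from (ψK N v)))
    where
    fibre : Fin 3 → Fin n
    fibre k = ψ⁻¹ (k , g)
    abc : Triple n
    abc = fibre 0F , fibre 1F , fibre 2F
    colours-differ : ∀ {k l} → k ≢ l → fibre k ≢ fibre l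
    colours-differ k≢l = k≢l ∘ cong proj₁ ∘ ψ⁻¹-injective
    to : ∀ {v} → v ∈T abc → ψG N v ≡ g
    to (inj₁ refl)        = cong proj₂ (ψ∘ψ⁻¹ _)
    to (inj₂ (inj₁ refl)) = cong proj₂ (ψ∘ψ⁻¹ _)
    to (inj₂ (inj₂ refl)) = cong proj₂ (ψ∘ψ⁻¹ _)
    from : ∀ k → fibre k ∈T abc
    from 0F = inj₁ refl
    from 1F = inj₂ (inj₁ refl)
    from 2F = inj₂ (inj₂ refl)

  compatible-with-fibre : ∀ {t s h} {α : Fin 3 → Fin n} → Indexing t α →
    (∀ {i j} → ψK N (α i) ≡ ψK N (α j) → i ≡ j) → IsCoreTriangle N h s →
    (∀ i → LinkedTo (α i) h) → Compatible H t s
  compatible-with-fibre {t} {s} {h} {α} α-indexing α-colours core linked =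
    disjoint , α , β , α-indexing , core-Indexing core (ψK N ∘ α) α-colours , λ i j →
      mk⇔ (λ αiβj j≡i → Equivalence.to (not-⌊≟⌋⇔≢ _ _) (trans (sym (edge i j)) αiβj) (cong (ψK N ∘ α) j≡i))
          (λ i≢j → trans (edge i j) (Equivalence.from (not-⌊≟⌋⇔≢ _ _) (i≢j ∘ α-colours)))
    where
    β : Fin 3 → Fin n
    β j = ψ⁻¹ (ψK N (α j) , h)

    disjoint : ∀ v → v ∈T t → ¬ (v ∈T s)
    disjoint v v∈t v∈s with proj₂ α-indexing v v∈t
    ... | i , refl with () ← trans (sym (subst (λ x → adj G x h ≡ true) (core-ψG core v∈s) (proj₁ (linked i))))
                                   (irrefl G h)

    edge : ∀ i j → adj H (α i) (β j) ≡ not ⌊ ψK N (α i) Fin.≟ ψK N (α j) ⌋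
    edge i j = begin
      adj H (α i) (β j)                  ≡⟨ iso N (α i) (β j) ⟩
      Hadj (ψ N (α i)) (ψ N (β j))       ≡⟨ cong (Hadj (ψ N (α i))) (ψ∘ψ⁻¹ _) ⟩
      Hadj (ψ N (α i)) (ψK N (α j) , h)  ≡⟨ cong₂ (λ a e → (c ∧ a) ∧ not e) (proj₁ (linked i)) (proj₂ (linked i) (ψK N (α j))) ⟩
      (c ∧ true) ∧ true                  ≡⟨ trans (Boolₚ.∧-identityʳ _) (Boolₚ.∧-identityʳ c) ⟩
      c                                  ∎
      where
      open ≡-Reasoning
      c = not ⌊ ψK N (α i) Fin.≟ ψK N (α j) ⌋

  core-compatible : ∀ {g h t s} → IsCoreTriangle N g t → IsCoreTriangle N h s → Linked g h → Compatible H t s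
  core-compatible {g} {h} core-t core-s (gh , clean) =
    compatible-with-fibre (core-Indexing core-t id id) colours core-s λ i →
      subst (λ x → adj G x h ≡ true) (sym (ψG∘ψ⁻¹ i)) gh ,
      λ y → subst (λ p → E' N p (y , h) ≡ false) (sym (ψ∘ψ⁻¹ (i , g))) (clean i y)
    where
    ψG∘ψ⁻¹ : ∀ i → ψG N (ψ⁻¹ (i , g)) ≡ g
    ψG∘ψ⁻¹ i = cong proj₂ (ψ∘ψ⁻¹ (i , g))
    colours : ∀ {i j} → ψK N (ψ⁻¹ (i , g)) ≡ ψK N (ψ⁻¹ (j , g)) → i ≡ j
    colours {i} {j} e = trans (sym (cong proj₁ (ψ∘ψ⁻¹ (i , g)))) (trans e (cong proj₁ (ψ∘ψ⁻¹ (j , g))))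

  module _ (0≤ε : ℚ.0ℚ ℚ.≤ ε) (ε≤1/40 : ε ℚ.≤ 1/40) where
    open Small 0≤ε ε≤1/40

    fibre-CAdj : ∀ {g u v} → u Fin.< v → ψG N u ≡ g → ψG N v ≡ g → CAdj ε H u v
    fibre-CAdj {u = u} {v} u<v ψGu≡g ψGv≡g =
      u≢v , (λ _ → fibre-pair-CandCond ψGu≡g ψGv≡g colours-differ)
          , (λ _ → fibre-pair-CandCond ψGv≡g ψGu≡g (colours-differ ∘ sym))
      where
      u≢v : u ≢ v
      u≢v = Finₚ.<⇒≢ u<v
      colours-differ : ψK N u ≢ ψK N v
      colours-differ ψKu≡ψKv = u≢v (ψ-injective (cong₂ _,_ ψKu≡ψKv (trans ψGu≡g (sym ψGv≡g))))

    core-IsTri : ∀ {g t} → IsCoreTriangle N g t → IsTri ε H t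
    core-IsTri {g} {t = x , y , z} core@((x<y , y<z) , _) =
      (x<y , y<z) , fibre-CAdj x<y (ψG∈ (inj₁ refl)) (ψG∈ (inj₂ (inj₁ refl)))
                  , fibre-CAdj (Finₚ.<-trans x<y y<z) (ψG∈ (inj₁ refl)) (ψG∈ (inj₂ (inj₂ refl)))
                  , fibre-CAdj y<z (ψG∈ (inj₂ (inj₁ refl))) (ψG∈ (inj₂ (inj₂ refl)))
      where
      ψG∈ : ∀ {w} → w ∈T (x , y , z) → ψG N w ≡ g
      ψG∈ = core-ψG core

sum-map-≤ : ∀ {A : Set} {f g : A → ℕ} → (∀ a → f a ≤ g a) → ∀ xs → sum (map f xs) ≤ sum (map g xs)
sum-map-≤ f≤g []       = z≤n
sum-map-≤ f≤g (x ∷ xs) = ℕₚ.+-mono-≤ (f≤g x) (sum-map-≤ f≤g xs)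

sum-map-< : ∀ {A : Set} {f g : A → ℕ} → (∀ a → f a ≤ g a) → ∀ {y xs} → y ∈ xs → f y ℕ.< g y →
            sum (map f xs) ℕ.< sum (map g xs)
sum-map-< f≤g {xs = _ ∷ xs} (here refl) fy<gy = ℕₚ.+-mono-<-≤ fy<gy (sum-map-≤ f≤g xs)
sum-map-< f≤g {xs = x ∷ _}  (there y∈) fy<gy = ℕₚ.+-mono-≤-< (f≤g x) (sum-map-< f≤g y∈ fy<gy)

miss : ∀ {P : Set} → Dec P → ℕ
miss P? = if does P? then 0 else 1

miss-mono : ∀ {P Q : Set} (P? : Dec P) (Q? : Dec Q) → (Q → P) → miss P? ≤ miss Q?
miss-mono (yes _) _       _   = z≤n
miss-mono (no ¬p) (yes q) q⇒p = contradiction (q⇒p q) ¬p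
miss-mono (no _)  (no _)  _   = ℕₚ.≤-refl

miss-< : ∀ {P Q : Set} (P? : Dec P) (Q? : Dec Q) → P → ¬ Q → miss P? ℕ.< miss Q?
miss-< (no ¬p) _       p _  = contradiction p ¬p
miss-< (yes _) (yes q) _ ¬q = contradiction q ¬q
miss-< (yes _) (no _)  _ _  = s≤s z≤n

module FiniteClosure {A : Set} (_≟_ : DecidableEquality A) (elements : List A) (complete : ∀ a → a ∈ elements)
                     {R : A → A → Set} (R? : ∀ a b → Dec (R a b)) where

  open import Data.List.Membership.DecPropositional _≟_ using (_∈?_)

  Closed : List A → Set
  Closed xs = ∀ {x y} → x ∈ xs → R x y → y ∈ xs

  private
    unvisited : List A → ℕ
    unvisited xs = sum (map (λ a → miss (a ∈? xs)) elements)

    unvisited-shrinks : ∀ {y xs} → y ∉ xs → unvisited (y ∷ xs) ℕ.< unvisited xs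
    unvisited-shrinks {y} {xs} y∉xs =
      sum-map-< (λ a → miss-mono (a ∈? (y ∷ xs)) (a ∈? xs) there) (complete y)
                (miss-< (y ∈? (y ∷ xs)) (y ∈? xs) (here refl) y∉xs)

    Frontier : List A → Set
    Frontier xs = Any (λ x → Any (λ y → R x y × y ∉ xs) elements) xs

    frontier? : ∀ xs → Dec (Frontier xs)
    frontier? xs = Any.any? (λ x → Any.any? (λ y → R? x y ×-dec ¬? (y ∈? xs)) elements) xs

    no-frontier⇒Closed : ∀ {xs} → ¬ Frontier xs → Closed xs
    no-frontier⇒Closed {xs} none {y = y} x∈xs Rxy with y ∈? xs
    ... | yes y∈xs = y∈xs
    ... | no  y∉xs = contradiction (lose x∈xs (lose (complete y) (Rxy , y∉xs))) none

  closure : (P : A → Set) → (∀ {x y} → P x → R x y → P y) → ∀ {a} → P a →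
            ∃ λ xs → a ∈ xs × (∀ {x} → x ∈ xs → P x) × Closed xs
  closure P P-step {a} Pa = grow (suc (unvisited (a ∷ []))) (a ∷ []) ℕₚ.≤-refl (here refl) λ { (here refl) → Pa }
    where
    grow : ∀ fuel xs → unvisited xs ℕ.< fuel → a ∈ xs → (∀ {x} → x ∈ xs → P x) →
           ∃ λ xs → a ∈ xs × (∀ {x} → x ∈ xs → P x) × Closed xs
    grow (suc fuel) xs bound a∈xs all-P with frontier? xs
    ... | no  none = xs , a∈xs , all-P , no-frontier⇒Closed none
    ... | yes some =
      let x , x∈xs , out = find some
          y , _ , Rxy , y∉xs = find out
          all-P′ : ∀ {z} → z ∈ y ∷ xs → P z
          all-P′ = λ { (here refl) → P-step (all-P x∈xs) Rxy ; (there z∈xs) → all-P z∈xs }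
      in grow fuel (y ∷ xs) (ℕₚ.<-≤-trans (unvisited-shrinks y∉xs) (ℕₚ.≤-pred bound)) (there a∈xs) all-P′

-- Decidability of reachability in 𝒯(C)

_⇔?_ : ∀ {A B : Set} → Dec A → Dec B → Dec (A ⇔ B)
yes a ⇔? yes b = yes (mk⇔ (λ _ → b) (λ _ → a))
no ¬a ⇔? no ¬b = yes (mk⇔ (λ a → contradiction a ¬a) (λ b → contradiction b ¬b))
yes a ⇔? no ¬b = no (λ a⇔b → ¬b (Equivalence.to a⇔b a))
no ¬a ⇔? yes b = no (λ a⇔b → ¬a (Equivalence.from a⇔b b))

_∈T?_ : ∀ {n} (v : Fin n) (t : Triple n) → Dec (v ∈T t)
v ∈T? (x , y , z) = (v Fin.≟ x) ⊎-dec (v Fin.≟ y) ⊎-dec (v Fin.≟ z)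

anyTriple? : ∀ {n} {P : Triple n → Set} → (∀ t → Dec (P t)) → Dec (Σ (Triple n) P)
anyTriple? P? = map′ (λ (x , y , z , p) → (x , y , z) , p) (λ ((x , y , z) , p) → x , y , z , p)
  (Finₚ.any? λ x → Finₚ.any? λ y → Finₚ.any? λ z → P? (x , y , z))

corner-tabulate : ∀ {n} (α : Fin 3 → Fin n) i → corner (α 0F , α 1F , α 2F) i ≡ α i
corner-tabulate α 0F = refl
corner-tabulate α 1F = refl
corner-tabulate α 2F = refl

Indexing-≗ : ∀ {n} {t : Triple n} {α β : Fin 3 → Fin n} → (∀ i → β i ≡ α i) → Indexing t α → Indexing t β
Indexing-≗ {t = t} β≗α (∈t , onto) =
  (λ i → subst (_∈T t) (sym (β≗α i)) (∈t i)) , λ v v∈t → let i , αi≡v = onto v v∈t in i , trans (β≗α i) αi≡v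

module Decidable {n : ℕ} (ε : ℚ) (H : Graph n) where

  CandCond? : ∀ u v → Dec (CandCond ε H u v)
  CandCond? u v = (_ ℚ.≤? _) ×-dec (_ ℚ.≤? _) ×-dec (_ ℚ.≤? _)

  CAdj? : ∀ u v → Dec (CAdj ε H u v)
  CAdj? u v = ¬? (u Fin.≟ v) ×-dec (deg H v ℕ.≤? deg H u →-dec CandCond? u v)
                              ×-dec (deg H u ℕ.≤? deg H v →-dec CandCond? v u)

  IsTri? : ∀ t → Dec (IsTri ε H t)
  IsTri? (x , y , z) = (x Fin.<? y ×-dec y Fin.<? z) ×-dec CAdj? x y ×-dec CAdj? x z ×-dec CAdj? y z

  Indexing? : ∀ (t : Triple n) α → Dec (Indexing t α)
  Indexing? t α = map′ (λ (∈t , hits) → ∈t , onto hits) (λ (∈t , onto) → ∈t , λ k → onto (corner t k) (corner∈ k))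
    (Finₚ.all? (λ i → α i ∈T? t) ×-dec Finₚ.all? (λ k → Finₚ.any? (λ i → α i Fin.≟ corner t k)))
    where
    corner∈ : ∀ k → corner t k ∈T t
    corner∈ = proj₁ (corner-Indexing t)
    onto : (∀ k → ∃ λ i → α i ≡ corner t k) → ∀ v → v ∈T t → ∃ λ i → α i ≡ v
    onto hits v v∈t = let k , k≡v = proj₂ (corner-Indexing t) v v∈t
                          i , i≡k = hits k
                      in i , trans i≡k k≡v

  Disjoint? : (t s : Triple n) → Dec (∀ v → v ∈T t → ¬ (v ∈T s))
  Disjoint? t s = map′ (λ miss v v∈t → let i , i≡v = proj₂ (corner-Indexing t) v v∈t
                                        in subst (λ w → ¬ w ∈T s) i≡v (miss i))
                       (λ disjoint i → disjoint (corner t i) (proj₁ (corner-Indexing t) i))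
                       (Finₚ.all? λ i → ¬? (corner t i ∈T? s))

  Alternating : (Fin 3 → Fin n) → (Fin 3 → Fin n) → Set
  Alternating α β = ∀ i j → (adj H (α i) (β j) ≡ true) ⇔ (i ≢ j)

  Alternating? : ∀ α β → Dec (Alternating α β)
  Alternating? α β = Finₚ.all? λ i → Finₚ.all? λ j → (adj H (α i) (β j) Boolₚ.≟ true) ⇔? ¬? (i Fin.≟ j)

  Compatible? : ∀ t s → Dec (Compatible H t s)
  Compatible? t s = Disjoint? t s ×-dec map′ from-triples to-triples
    (anyTriple? λ a → anyTriple? λ b →
      Indexing? t (corner a) ×-dec Indexing? s (corner b) ×-dec Alternating? (corner a) (corner b))
    where
    Indexings : Set
    Indexings = Σ (Fin 3 → Fin n) λ α → Σ (Fin 3 → Fin n) λ β → Indexing t α × Indexing s β × Alternating α β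
    TripleIndexings : Set
    TripleIndexings = Σ (Triple n) λ a → Σ (Triple n) λ b →
                        Indexing t (corner a) × Indexing s (corner b) × Alternating (corner a) (corner b)
    from-triples : TripleIndexings → Indexings
    from-triples (a , b , idx-a , idx-b , alt) = corner a , corner b , idx-a , idx-b , alt
    to-triples : Indexings → TripleIndexings
    to-triples (α , β , idx-α , idx-β , alt) =
      (α 0F , α 1F , α 2F) , (β 0F , β 1F , β 2F) , Indexing-≗ α≗ idx-α , Indexing-≗ β≗ idx-β
        , λ i j → subst₂ (λ a b → (adj H a b ≡ true) ⇔ (i ≢ j)) (sym (α≗ i)) (sym (β≗ j)) (alt i j)
      where
      α≗ : ∀ i → corner (α 0F , α 1F , α 2F) i ≡ α i
      α≗ = corner-tabulate α
      β≗ : ∀ i → corner (β 0F , β 1F , β 2F) i ≡ β i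
      β≗ = corner-tabulate β

  TAdj? : ∀ t s → Dec (TAdj ε H t s)
  TAdj? t s = IsTri? t ×-dec IsTri? s ×-dec Compatible? t s

  triples : List (Triple n)
  triples = cartesianProduct (allFin n) (cartesianProduct (allFin n) (allFin n))

  ∈-triples : ∀ t → t ∈ triples
  ∈-triples (x , y , z) = ∈-cartesianProduct⁺ (∈-allFin x) (∈-cartesianProduct⁺ (∈-allFin y) (∈-allFin z))

  _≟T_ : DecidableEquality (Triple n)
  _≟T_ = ≡-dec Fin._≟_ (≡-dec Fin._≟_ Fin._≟_)

  open FiniteClosure _≟T_ triples ∈-triples TAdj? using (Closed; closure)
  open import Data.List.Membership.DecPropositional _≟T_ using (_∈?_)

  TReach? : ∀ t s → Dec (TReach ε H t s)
  TReach? t s = decide (closure (TReach ε H t) step here)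
    where
    decide : (∃ λ xs → t ∈ xs × (∀ {x} → x ∈ xs → TReach ε H t x) × Closed xs) → Dec (TReach ε H t s)
    decide (xs , t∈xs , reached , closed) = map′ reached inside (s ∈? xs)
      where
      inside : ∀ {r} → TReach ε H t r → r ∈ xs
      inside here           = t∈xs
      inside (step t⇝r r~r′) = closed (inside t⇝r) r~r′

module _ {n : ℕ} {ε : ℚ} {H : Graph n} where

  CAdj-sym : ∀ {u v} → CAdj ε H u v → CAdj ε H v u
  CAdj-sym (u≢v , cond , cond′) = u≢v ∘ sym , cond′ , cond

  CReach-prepend : ∀ {a b c} → CAdj ε H a b → CReach ε H b c → CReach ε H a c
  CReach-prepend ab here          = step here ab
  CReach-prepend ab (step b⇝x xc) = step (CReach-prepend ab b⇝x) xc

  CReach-sym : ∀ {a b} → CReach ε H a b → CReach ε H b a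
  CReach-sym here            = here
  CReach-sym (step a⇝v adj) = CReach-prepend (CAdj-sym adj) (CReach-sym a⇝v)

module Confusability {m : ℕ} (ε : ℚ) (G : Graph m) where

  Confusable-sym : ∀ g g′ → Confusable ε G g g′ → Confusable ε G g′ g
  Confusable-sym g g′ = subst₂ (λ a b → (ℚ.1ℚ ℚ.- ⟦ 9 ⟧ ℚ.* ε) ℚ.* ⟦ a ⟧ ℚ.< ⟦ b ⟧)
    (ℕₚ.⊔-comm (deg G g) (deg G g′)) (count-cong (λ w → Boolₚ.∧-comm (adj G g w) (adj G g′ w)))

  Confusable⇒0≤ε : ∀ g g′ → Confusable ε G g g′ → ℚ.0ℚ ℚ.≤ ε
  Confusable⇒0≤ε g g′ =
    confusable⇒0≤ε ε ⟦ deg G g ℕ.⊔ deg G g′ ⟧ ⟦ common G g g′ ⟧ (0≤⟦⟧ (deg G g ℕ.⊔ deg G g′))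
      (⟦⟧-mono-≤ (ℕₚ.≤-trans (common-≤-deg G g g′) (ℕₚ.m≤m⊔n (deg G g) (deg G g′))))

0<-half : ∀ {k d} → 0 ℕ.< k → k ≤ 2 * d → 0 ℕ.< d
0<-half {d = zero}  0<k k≤0 = contradiction (ℕₚ.<-≤-trans 0<k k≤0) (λ ())
0<-half {d = suc d} _   _   = s≤s z≤n

module CoreComponentLemma {ε : ℚ} (ε<1/40 : ε ℚ.< 1/40) {m n : ℕ} {G : Graph m} {H : Graph n}
                          (N : Near ε G H) {t₀ : Triple n} (core-component : CoreComponent N t₀) where
  open NearGraph N
  open CoreTriangles N
  open Decidable ε H using (TReach?)
  open Confusability ε G

  QuasiCore-reached : ∀ {s} → TReach ε H t₀ s → QuasiCore N s
  QuasiCore-reached = proj₂ core-component _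

  -- ε ≥ 0 is not a hypothesis; it follows from the confusability in t₀.
  0≤ε : ℚ.0ℚ ℚ.≤ ε
  0≤ε = let _ , _ , _ , conf , _ = QuasiCore-reached here in
    Confusable⇒0≤ε (ψG N (proj₁ t₀)) (ψG N (proj₁ (proj₂ t₀))) conf

  ε≤1/40 : ε ℚ.≤ 1/40
  ε≤1/40 = ℚₚ.<⇒≤ ε<1/40

  open Small 0≤ε ε≤1/40

  Reached : Fin m → Set
  Reached g = ∀ t → IsCoreTriangle N g t → TReach ε H t₀ t

  -- Positive degree travels along with reachedness: the counting behind CAdj-neighbour needs it.
  Live : Fin m → Set
  Live g = 0 ℕ.< deg G g × Reached g

  core-TAdj : ∀ {g h t s} → IsCoreTriangle N g t → IsCoreTriangle N h s → Linked g h → TAdj ε H t s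
  core-TAdj core-t core-s linked =
    core-IsTri 0≤ε ε≤1/40 core-t , core-IsTri 0≤ε ε≤1/40 core-s , core-compatible core-t core-s linked

  Reached-Linked : ∀ {g h} → Linked g h → Reached g → Reached h
  Reached-Linked {g} linked reached s core-s =
    let t , core-t = coreTriangle g in step (reached t core-t) (core-TAdj core-t core-s linked)

  Live-CAdj : ∀ {u v} → CAdj ε H u v → Live (ψG N u) → Live (ψG N v)
  Live-CAdj {u} {v} adj (0<d , reached) =
    let 0<du = fibre-deg-pos u 0<d
        h , linked-u , linked-v = CAdj-neighbour adj 0<du
    in 0<-half (candidate-deg-pos adj 0<du) (deg-≤ v)
     , Reached-Linked (Linked-sym linked-v) (Reached-Linked linked-u reached)

  Live-CReach : ∀ {a b} → CReach ε H a b → Live (ψG N a) → Live (ψG N b)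
  Live-CReach here           = id
  Live-CReach (step a⇝v adj) = Live-CAdj adj ∘ Live-CReach a⇝v

  IsTri-reached : ∀ {s} → TReach ε H t₀ s → IsTri ε H s
  IsTri-reached here                   = proj₁ core-component
  IsTri-reached (step _ (_ , tri , _)) = tri

  pivot : ∀ {s v} → QuasiCore N s → v ∈T s → Σ (Fin n × Fin n) λ (a , b) →
    Confusable ε G (ψG N v) (ψG N a) × Confusable ε G (ψG N v) (ψG N b) × (∀ w → w ∈T s → w ∈T (v , a , b))
  pivot {x , y , z} (_ , _ , _ , xy , xz , yz) (inj₁ refl) = (y , z) , xy , xz , λ _ → id
  pivot {x , y , z} (_ , _ , _ , xy , xz , yz) (inj₂ (inj₁ refl)) =
    (x , z) , Confusable-sym (ψG N x) (ψG N y) xy , yz , λ _ → swap₁₂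
  pivot {x , y , z} (_ , _ , _ , xy , xz , yz) (inj₂ (inj₂ refl)) =
    (x , y) , Confusable-sym (ψG N x) (ψG N z) xz , Confusable-sym (ψG N y) (ψG N z) yz , λ _ → swap₁₂ ∘ swap₂₃

  colours-injective : ∀ {s} → QuasiCore N s → ∀ {i j} → ψK N (corner s i) ≡ ψK N (corner s j) → i ≡ j
  colours-injective {x , y , z} (x≢y , x≢z , y≢z , _) = corner-injective (ψK N) x≢y x≢z y≢z

  Reached-fibre : ∀ {s h} → TReach ε H t₀ s → (∀ i → LinkedTo (corner s i) h) → Reached h
  Reached-fibre {s} t₀⇝s linked th core-h =
    step t₀⇝s (IsTri-reached t₀⇝s , core-IsTri 0≤ε ε≤1/40 core-h ,
               compatible-with-fibre (corner-Indexing s) (colours-injective (QuasiCore-reached t₀⇝s)) core-h linked)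

  Live-reached : ∀ {s} → TReach ε H t₀ s → ∀ {v} → v ∈T s → Live (ψG N v)
  Live-reached {s} t₀⇝s {v} v∈s =
    let (a , b) , conf-a , conf-b , s⊆vab = pivot (QuasiCore-reached t₀⇝s) v∈s
        h , linked , to-v , to-a , to-b = quasi-core-neighbour v a b conf-a conf-b
    in confusable-deg-pos (ψG N v) (ψG N a) conf-a
     , Reached-Linked (Linked-sym linked) (Reached-fibre t₀⇝s λ i →
         ∈T-∀ (λ w → LinkedTo w h) to-v to-a to-b (s⊆vab (corner s i) (proj₁ (corner-Indexing s) i)))

  AllCoreReached Untouched : Fin n → Set
  AllCoreReached c₀ = ∀ g t → IsCoreTriangle N g t → (∀ v → v ∈T t → CReach ε H c₀ v) → TReach ε H t₀ t
  Untouched c₀ = ∀ s → TReach ε H t₀ s → ∀ v → v ∈T s → ¬ CReach ε H c₀ v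

  component-dichotomy : ∀ c₀ → AllCoreReached c₀ ⊎ Untouched c₀
  component-dichotomy c₀ = decide (TReach? t₀ tc)
    where
    tc : Triple n
    tc = proj₁ (coreTriangle (ψG N c₀))
    core-c : IsCoreTriangle N (ψG N c₀) tc
    core-c = proj₂ (coreTriangle (ψG N c₀))
    decide : Dec (TReach ε H t₀ tc) → AllCoreReached c₀ ⊎ Untouched c₀
    decide (yes t₀⇝tc) = inj₁ λ g t core-t c₀⇝t →
      let x∈t = proj₁ (corner-Indexing t) 0F
      in subst Reached (core-ψG core-t x∈t) (proj₂ (Live-CReach (c₀⇝t _ x∈t) live-c₀)) t core-t
      where
      x∈tc : corner tc 0F ∈T tc
      x∈tc = proj₁ (corner-Indexing tc) 0F
      live-c₀ : Live (ψG N c₀)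
      live-c₀ = subst Live (core-ψG core-c x∈tc) (Live-reached t₀⇝tc x∈tc)
    decide (no ¬t₀⇝tc) = inj₂ λ s t₀⇝s v v∈s c₀⇝v →
      ¬t₀⇝tc (proj₂ (Live-CReach (CReach-sym c₀⇝v) (Live-reached t₀⇝s v∈s)) tc core-c)

lemma3p7 : (ε : ℚ) → ε < (+ 1 / 40) →
    {m n : ℕ} (G : Graph m) (H : Graph n) (N : Near ε G H) →
    (c₀ : Fin n) (t₀ : Triple n) → CoreComponent N t₀ →
    (∀ g t → IsCoreTriangle N g t → (∀ v → v ∈T t → CReach ε H c₀ v) → TReach ε H t₀ t)
    ⊎ (∀ s → TReach ε H t₀ s → ∀ v → v ∈T s → ¬ CReach ε H c₀ v)
lemma3p7 ε ε<1/40 G H N c₀ t₀ core-component =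
  CoreComponentLemma.component-dichotomy ε<1/40 N core-component c₀
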